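{- Let $q$ be a prime power, let $\delta\in\mathbb{F}_{q^2}$ satisfy $\delta^{q+1}=1$, and let $m$ be an integer with $2\le m<q$. Then there are at least $q(q-1)^2$ linearized polynomials $L(x)=\alpha_1x^q+\alpha_0x$ over $\mathbb{F}_{q^2}$ of rank $2$ such that $(x^q+\delta x)^m+L(x)$ is a (normalized) permutation polynomial of $\mathbb{F}_{q^2}$.
   Context: $\mathbb{F}_{q^2}$ is regarded as a $2$-dimensional $\mathbb{F}_q$-vector space. A linearized polynomial over $\mathbb{F}_{q^2}$ is $L(x)=\alpha_1x^q+\alpha_0x$ with $\alpha_0,\alpha_1\in\mathbb{F}_{q^2}$; its rank is the rank of the $\mathbb{F}_q$-linear evaluation map. A permutation polynomial of $\mathbb{F}_{q^2}$ is one whose evaluation map is a bijection of $\mathbb{F}_{q^2}$; "normalized" means monic and mapping $0$ to $0$. -}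

module Defs where

open import Level using (0ℓ)
open import Data.Nat using (ℕ; zero; suc; _≤_) renaming (_^_ to _^ℕ_)
open import Data.Nat.Primality using (Prime)
open import Data.Fin using (Fin)
open import Data.Product using (Σ; ∃; _×_; _,_)
open import Relation.Nullary using (¬_)
open import Relation.Binary.PropositionalEquality using (_≡_)
open import Algebra.Bundles using (CommutativeRing)

IsPrimePower : ℕ → Set
IsPrimePower q = Σ ℕ λ p → Σ ℕ λ k → Prime p × (1 ≤ k) × (q ≡ p ^ℕ k)

record FiniteField (n : ℕ) : Set₁ where
  field
    cring : CommutativeRing 0ℓ 0ℓ
  open CommutativeRing cring public
  field
    1≉0     : ¬ (1# ≈ 0#)
    inverse : ∀ x → ¬ (x ≈ 0#) → ∃ λ y → (x * y) ≈ 1#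
    enum    : Fin n → Carrier
    enum-injective  : ∀ i j → enum i ≈ enum j → i ≡ j
    enum-surjective : ∀ x → ∃ λ i → enum i ≈ x

  infixr 8 _^_
  _^_ : Carrier → ℕ → Carrier
  x ^ zero = 1#
  x ^ suc n = x * (x ^ n)

  IsBijective : (Carrier → Carrier) → Set
  IsBijective f = (∀ x y → f x ≈ f y → x ≈ y) × (∀ y → ∃ λ x → f x ≈ y)

module _ (q : ℕ) (F : FiniteField (q ^ℕ 2)) where
  open FiniteField F

  linEval : Carrier × Carrier → Carrier → Carrier
  linEval (α₀ , α₁) x = (α₁ * (x ^ q)) + (α₀ * x)

  -- rank 2: the F_q-linear evaluation map F_{q²} → F_{q²} has 2-dimensional
  -- image, i.e. its image is all of F_{q²}
  HasRank2 : Carrier × Carrier → Set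
  HasRank2 α = ∀ y → ∃ λ x → linEval α x ≈ y

  permCandidate : Carrier → ℕ → Carrier × Carrier → Carrier → Carrier
  permCandidate δ m α x = (((x ^ q) + (δ * x)) ^ m) + linEval α x

  -- normalized permutation polynomial: bijective evaluation map and 0 ↦ 0
  -- (monicity is automatic: leading term x^{qm}, qm < q², coefficient 1)
  IsNormalizedPP : Carrier → ℕ → Carrier × Carrier → Set
  IsNormalizedPP δ m α =
    IsBijective (permCandidate δ m α) × (permCandidate δ m α 0# ≈ 0#)

{-# OPTIONS --safe #-}

-- Write σ x = x ^ q and N x = x * σ x. Since |F| = q², the binomial theorem in characteristic p
-- and Fermat's little theorem make σ an involutive automorphism, whose fixed field has at least
-- q elements because every y is re y + im y * θ with re y and im y fixed. For T x = σ x + δ x and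
-- L x = α₁ * σ x + α₀ * x with N α₀ ≠ N α₁, L is invertible, and f = T ^ m + L is a permutation
-- as soon as T ∘ L⁻¹ kills the values of T ^ m, because then T ∘ L⁻¹ ∘ f = T. These values h
-- satisfy σ h = (σ δ) ^ m * h, and T ∘ L⁻¹ kills all such h when β = α₀ - δ * α₁ satisfies
-- σ β = - (σ δ) ^ (m + 1) * β, that is (Hilbert 90) β lies on a line b · F_q. Choosing β ≠ 0
-- there (q - 1 ways), the trace of δ * σ β * α₁ among the q - 1 values keeping N α₀ ≠ N α₁, and
-- its trace-zero part (q ways) gives q (q - 1)² distinct pairs (α₀ , α₁).
module Submission where

open import Algebra.Bundles using (CommutativeMonoid; CommutativeRing; RawRing)
import Algebra.Properties.CommutativeMonoid.Sum as CMSum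
open import Algebra.Solver.Ring.AlmostCommutativeRing using (fromCommutativeRing; _-Raw-AlmostCommutative⟶_)
open import Data.Empty using (⊥-elim)
open import Data.Fin as Fin using (Fin)
open import Data.Fin.Permutation using (Permutation; permutation)
import Data.Fin.Properties as Fin
open import Data.Integer as ℤ using (ℤ; +_; -[1+_]; _⊖_; 0ℤ; 1ℤ)
import Data.Integer.Properties as ℤ
open import Data.Maybe using (Maybe; just; nothing)
open import Data.Nat as ℕ using (ℕ; zero; suc)
open import Data.Nat.Primality using (Prime; prime⇒nonTrivial; prime⇒nonZero; euclidsLemma)
import Data.Nat.Properties as ℕ
open import Data.Product using (Σ; ∃; _×_; _,_; proj₁; proj₂; uncurry)
open import Data.Sign as Sign using (Sign)
open import Data.Sum using (_⊎_; inj₁; inj₂)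
open import Level using (0ℓ)
open import Relation.Binary.PropositionalEquality as ≡ using (_≡_; _≢_)
open import Relation.Nullary using (¬_; Dec; yes; no)

open import Defs

module RingSolver {c ℓ} (R : CommutativeRing c ℓ) where
  open CommutativeRing R
  open import Algebra.Properties.Ring ring using (-‿distribˡ-*; -‿distribʳ-*; -0#≈0#)
  open import Algebra.Properties.Group +-group using (//-rightDividesʳ)
  open import Algebra.Properties.AbelianGroup +-abelianGroup using (⁻¹-∙-comm; ⁻¹-involutive)
  open import Algebra.Properties.Semiring.Mult.TCOptimised semiring using (×-homo-+; ×1-homo-*) renaming (_×_ to _·_)
  open import Relation.Binary.Reasoning.Setoid setoid

  -- With the type-checking-optimised multiple, 1 · x reduces to x, so the solver constant
  -- con 1ℤ denotes 1# itself and solver instances match goals definitionally.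
  fromℤ : ℤ → Carrier
  fromℤ (+ n)    = n · 1#
  fromℤ -[1+ n ] = - (suc n · 1#)

  fromℤ-neg+ : ∀ n → fromℤ (ℤ.- (+ n)) ≈ - (n · 1#)
  fromℤ-neg+ zero    = sym -0#≈0#
  fromℤ-neg+ (suc n) = refl

  fromℤ-⊖ : ∀ m n → fromℤ (m ⊖ n) ≈ m · 1# - n · 1#
  fromℤ-⊖ m n with ℕ.≤-total n m
  ... | inj₁ n≤m rewrite ℤ.⊖-≥ n≤m = begin
    (m ℕ.∸ n) · 1#                      ≈⟨ //-rightDividesʳ (n · 1#) _ ⟨
    (m ℕ.∸ n) · 1# + n · 1# - n · 1#    ≈⟨ +-congʳ (×-homo-+ 1# (m ℕ.∸ n) n) ⟨
    (m ℕ.∸ n ℕ.+ n) · 1# - n · 1#       ≡⟨ ≡.cong (λ k → k · 1# - n · 1#) (ℕ.m∸n+n≡m n≤m) ⟩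
    m · 1# - n · 1#                     ∎
  ... | inj₂ m≤n rewrite ℤ.⊖-≤ m≤n = begin
    fromℤ (ℤ.- (+ k))                   ≈⟨ fromℤ-neg+ k ⟩
    - (k · 1#)                          ≈⟨ //-rightDividesʳ (m · 1#) _ ⟨
    - (k · 1#) + m · 1# - m · 1#        ≈⟨ +-congʳ (+-comm _ _) ⟩
    m · 1# - k · 1# - m · 1#            ≈⟨ +-assoc _ _ _ ⟩
    m · 1# + (- (k · 1#) - m · 1#)      ≈⟨ +-congˡ (⁻¹-∙-comm _ _) ⟩
    m · 1# - (k · 1# + m · 1#)          ≈⟨ +-congˡ (-‿cong (+-comm _ _)) ⟩
    m · 1# - (m · 1# + k · 1#)          ≈⟨ +-congˡ (-‿cong (×-homo-+ 1# m k)) ⟨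
    m · 1# - (m ℕ.+ k) · 1#             ≡⟨ ≡.cong (λ j → m · 1# - j · 1#) (ℕ.m+[n∸m]≡n m≤n) ⟩
    m · 1# - n · 1#                     ∎
    where k = n ℕ.∸ m

  fromℤ-+ : ∀ i j → fromℤ (i ℤ.+ j) ≈ fromℤ i + fromℤ j
  fromℤ-+ -[1+ m ] -[1+ n ] = begin
    - (suc (suc (m ℕ.+ n)) · 1#)        ≡⟨ ≡.cong (λ k → - (k · 1#)) (ℕ.+-suc (suc m) n) ⟨
    - ((suc m ℕ.+ suc n) · 1#)          ≈⟨ -‿cong (×-homo-+ 1# (suc m) (suc n)) ⟩
    - (suc m · 1# + suc n · 1#)         ≈⟨ ⁻¹-∙-comm _ _ ⟨
    - (suc m · 1#) - suc n · 1#         ∎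
  fromℤ-+ -[1+ m ] (+ n)    = trans (fromℤ-⊖ n (suc m)) (+-comm _ _)
  fromℤ-+ (+ m)    -[1+ n ] = fromℤ-⊖ m (suc n)
  fromℤ-+ (+ m)    (+ n)    = ×-homo-+ 1# m n

  fromℤ-neg : ∀ i → fromℤ (ℤ.- i) ≈ - fromℤ i
  fromℤ-neg -[1+ n ] = sym (⁻¹-involutive _)
  fromℤ-neg (+ n)    = fromℤ-neg+ n

  signed : Sign → Carrier → Carrier
  signed Sign.+ x = x
  signed Sign.- x = - x

  signed-cong : ∀ s {x y} → x ≈ y → signed s x ≈ signed s y
  signed-cong Sign.+ x≈y = x≈y
  signed-cong Sign.- x≈y = -‿cong x≈y

  signed-* : ∀ s t x y → signed (s Sign.* t) (x * y) ≈ signed s x * signed t y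
  signed-* Sign.- Sign.- x y = begin
    x * y              ≈⟨ ⁻¹-involutive _ ⟨
    - - (x * y)        ≈⟨ -‿cong (-‿distribʳ-* x y) ⟩
    - (x * - y)        ≈⟨ -‿distribˡ-* x (- y) ⟩
    - x * - y          ∎
  signed-* Sign.- Sign.+ x y = -‿distribˡ-* x y
  signed-* Sign.+ Sign.- x y = -‿distribʳ-* x y
  signed-* Sign.+ Sign.+ x y = refl

  fromℤ-◃ : ∀ s n → fromℤ (s ℤ.◃ n) ≈ signed s (n · 1#)
  fromℤ-◃ Sign.- zero    = sym -0#≈0#
  fromℤ-◃ Sign.+ zero    = refl
  fromℤ-◃ Sign.- (suc n) = refl
  fromℤ-◃ Sign.+ (suc n) = refl

  fromℤ-signAbs : ∀ i → fromℤ i ≈ signed (ℤ.sign i) (ℤ.∣ i ∣ · 1#)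
  fromℤ-signAbs -[1+ n ]  = refl
  fromℤ-signAbs (+ zero)  = refl
  fromℤ-signAbs (+ suc n) = refl

  fromℤ-* : ∀ i j → fromℤ (i ℤ.* j) ≈ fromℤ i * fromℤ j
  fromℤ-* i j = begin
    fromℤ (s ℤ.◃ ∣i∣ ℕ.* ∣j∣)                        ≈⟨ fromℤ-◃ s (∣i∣ ℕ.* ∣j∣) ⟩
    signed s ((∣i∣ ℕ.* ∣j∣) · 1#)                   ≈⟨ signed-cong s (×1-homo-* ∣i∣ ∣j∣) ⟩
    signed s (∣i∣ · 1# * ∣j∣ · 1#)                  ≈⟨ signed-* (ℤ.sign i) (ℤ.sign j) _ _ ⟩
    signed (ℤ.sign i) (∣i∣ · 1#) * signed (ℤ.sign j) (∣j∣ · 1#) ≈⟨ *-cong (fromℤ-signAbs i) (fromℤ-signAbs j) ⟨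
    fromℤ i * fromℤ j                               ∎
    where s = ℤ.sign i Sign.* ℤ.sign j
          ∣i∣ = ℤ.∣ i ∣
          ∣j∣ = ℤ.∣ j ∣

  ℤ-rawRing : RawRing _ _
  ℤ-rawRing = record
    { _≈_ = _≡_ ; _+_ = ℤ._+_ ; _*_ = ℤ._*_ ; -_ = ℤ.-_ ; 0# = + 0 ; 1# = + 1 }

  fromℤ-morphism : ℤ-rawRing -Raw-AlmostCommutative⟶ fromCommutativeRing R
  fromℤ-morphism = record
    { ⟦_⟧ = fromℤ ; +-homo = fromℤ-+ ; *-homo = fromℤ-* ; -‿homo = fromℤ-neg
    ; 0-homo = refl ; 1-homo = refl }

  fromℤ-≟ : ∀ i j → Maybe (fromℤ i ≈ fromℤ j)
  fromℤ-≟ i j with i ℤ.≟ j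
  ... | yes ≡.refl = just refl
  ... | no _       = nothing

  open import Algebra.Solver.Ring ℤ-rawRing (fromCommutativeRing R) fromℤ-morphism fromℤ-≟ public

module FieldProperties {n : ℕ} (F : FiniteField n) where
  open FiniteField F
  open RingSolver cring using (solve; _:=_; _:+_; _:*_; _:-_; con)
  open import Relation.Binary.Reasoning.Setoid setoid

  index : Carrier → Fin n
  index x = proj₁ (enum-surjective x)

  enum-index : ∀ x → enum (index x) ≈ x
  enum-index x = proj₂ (enum-surjective x)

  index-cong : ∀ {x y} → x ≈ y → index x ≡ index y
  index-cong {x} {y} x≈y = enum-injective _ _ (trans (enum-index x) (trans x≈y (sym (enum-index y))))

  index-enum : ∀ i → index (enum i) ≡ i
  index-enum i = enum-injective _ _ (enum-index (enum i))

  infix 4 _≟_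
  _≟_ : ∀ x y → Dec (x ≈ y)
  x ≟ y with index x Fin.≟ index y
  ... | yes i≡j = yes (trans (sym (enum-index x)) (trans (reflexive (≡.cong enum i≡j)) (enum-index y)))
  ... | no  i≢j = no (λ x≈y → i≢j (index-cong x≈y))

  -- 0# ⁻¹ is the junk value 0#.
  infix 9 _⁻¹
  _⁻¹ : Carrier → Carrier
  x ⁻¹ with x ≟ 0#
  ... | yes _   = 0#
  ... | no  x≉0 = proj₁ (inverse x x≉0)

  *-inverseʳ : ∀ {x} → x ≉ 0# → x * x ⁻¹ ≈ 1#
  *-inverseʳ {x} x≉0 with x ≟ 0#
  ... | yes x≈0  = ⊥-elim (x≉0 x≈0)
  ... | no  x≉0′ = proj₂ (inverse x x≉0′)

  *-inverseˡ : ∀ {x} → x ≉ 0# → x ⁻¹ * x ≈ 1#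
  *-inverseˡ x≉0 = trans (*-comm _ _) (*-inverseʳ x≉0)

  ⁻¹-*-cancelˡ : ∀ {c} → c ≉ 0# → ∀ x → c ⁻¹ * (c * x) ≈ x
  ⁻¹-*-cancelˡ {c} c≉0 x = begin
    c ⁻¹ * (c * x)   ≈⟨ *-assoc _ _ _ ⟨
    c ⁻¹ * c * x     ≈⟨ *-congʳ (*-inverseˡ c≉0) ⟩
    1# * x           ≈⟨ *-identityˡ x ⟩
    x                ∎

  *-⁻¹-cancelˡ : ∀ {c} → c ≉ 0# → ∀ x → c * (c ⁻¹ * x) ≈ x
  *-⁻¹-cancelˡ {c} c≉0 x = begin
    c * (c ⁻¹ * x)   ≈⟨ *-assoc _ _ _ ⟨
    c * c ⁻¹ * x     ≈⟨ *-congʳ (*-inverseʳ c≉0) ⟩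
    1# * x           ≈⟨ *-identityˡ x ⟩
    x                ∎

  *-cancelˡ : ∀ {c x y} → c ≉ 0# → c * x ≈ c * y → x ≈ y
  *-cancelˡ {c} {x} {y} c≉0 cx≈cy = begin
    x                ≈⟨ ⁻¹-*-cancelˡ c≉0 x ⟨
    c ⁻¹ * (c * x)   ≈⟨ *-congˡ cx≈cy ⟩
    c ⁻¹ * (c * y)   ≈⟨ ⁻¹-*-cancelˡ c≉0 y ⟩
    y                ∎

  *-integral : ∀ {x y} → x * y ≈ 0# → x ≈ 0# ⊎ y ≈ 0#
  *-integral {x} {y} xy≈0 with x ≟ 0#
  ... | yes x≈0 = inj₁ x≈0
  ... | no  x≉0 = inj₂ (*-cancelˡ x≉0 (trans xy≈0 (sym (zeroʳ x))))

  *-nonzero : ∀ {x y} → x ≉ 0# → y ≉ 0# → x * y ≉ 0#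
  *-nonzero x≉0 y≉0 xy≈0 with *-integral xy≈0
  ... | inj₁ x≈0 = x≉0 x≈0
  ... | inj₂ y≈0 = y≉0 y≈0

  ^-cong : ∀ {x y} m → x ≈ y → x ^ m ≈ y ^ m
  ^-cong zero    x≈y = refl
  ^-cong (suc m) x≈y = *-cong x≈y (^-cong m x≈y)

  ^-distribˡ-+-* : ∀ x a b → x ^ (a ℕ.+ b) ≈ x ^ a * x ^ b
  ^-distribˡ-+-* x zero    b = sym (*-identityˡ _)
  ^-distribˡ-+-* x (suc a) b = trans (*-congˡ (^-distribˡ-+-* x a b)) (sym (*-assoc _ _ _))

  ^-*-assoc : ∀ x a b → (x ^ a) ^ b ≈ x ^ (a ℕ.* b)
  ^-*-assoc x a zero    rewrite ℕ.*-zeroʳ a = refl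
  ^-*-assoc x a (suc b) rewrite ℕ.*-suc a b =
    trans (*-congˡ (^-*-assoc x a b)) (sym (^-distribˡ-+-* x a (a ℕ.* b)))

  ^-distribʳ-* : ∀ x y m → (x * y) ^ m ≈ x ^ m * y ^ m
  ^-distribʳ-* x y zero    = sym (*-identityˡ _)
  ^-distribʳ-* x y (suc m) = trans (*-congˡ (^-distribʳ-* x y m))
    (solve 4 (λ x y a b → (x :* y) :* (a :* b) := (x :* a) :* (y :* b)) refl x y (x ^ m) (y ^ m))

  1^m≈1 : ∀ m → 1# ^ m ≈ 1#
  1^m≈1 zero    = refl
  1^m≈1 (suc m) = trans (*-identityˡ _) (1^m≈1 m)

  ^-nonzero : ∀ {x} m → x ≉ 0# → x ^ m ≉ 0#
  ^-nonzero zero    x≉0 = 1≉0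
  ^-nonzero (suc m) x≉0 = *-nonzero x≉0 (^-nonzero m x≉0)

  ^≈0⇒≈0 : ∀ {x} m → x ^ m ≈ 0# → x ≈ 0#
  ^≈0⇒≈0 {x} m x^m≈0 with x ≟ 0#
  ... | yes x≈0 = x≈0
  ... | no  x≉0 = ⊥-elim (^-nonzero m x≉0 x^m≈0)

  record DistinctElements (k : ℕ) (P : Carrier → Set) : Set where
    field
      pick           : Fin k → Carrier
      pick-injective : ∀ i j → pick i ≈ pick j → i ≡ j
      pick-valid     : ∀ i → P (pick i)

module FiniteFieldCounting {n : ℕ} (F : FiniteField n) where
  open FiniteField F
  open FieldProperties F
  open import Algebra.Properties.Semiring.Mult semiring using (×1-homo-*) renaming (_×_ to _·_)
  open import Relation.Binary.Reasoning.Setoid setoid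

  module _ (h h⁻ : Carrier → Carrier)
           (h-cong : ∀ {x y} → x ≈ y → h x ≈ h y) (h⁻-cong : ∀ {x y} → x ≈ y → h⁻ x ≈ h⁻ y)
           (h∘h⁻ : ∀ x → h (h⁻ x) ≈ x) (h⁻∘h : ∀ x → h⁻ (h x) ≈ x) where

    permutationOf : Permutation n n
    permutationOf = permutation (λ i → index (h (enum i))) (λ i → index (h⁻ (enum i)))
      (λ i → ≡.trans (index-cong (trans (h-cong (enum-index _)) (h∘h⁻ _))) (index-enum i))
      (λ i → ≡.trans (index-cong (trans (h⁻-cong (enum-index _)) (h⁻∘h _))) (index-enum i))

    module _ (M : CommutativeMonoid 0ℓ 0ℓ) (g : Carrier → CommutativeMonoid.Carrier M)
             (g-cong : ∀ {x y} → x ≈ y → CommutativeMonoid._≈_ M (g x) (g y)) where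
      open CommutativeMonoid M using () renaming (_≈_ to _≈ᴹ_; trans to transᴹ; sym to symᴹ)
      open CMSum M using (sum; ∑-permute; sum-cong-≋)

      sum-∘-bijection : sum (λ i → g (h (enum i))) ≈ᴹ sum (λ i → g (enum i))
      sum-∘-bijection = transᴹ (sum-cong-≋ {n} (λ i → g-cong (sym (enum-index _))))
                               (symᴹ (∑-permute (λ i → g (enum i)) permutationOf))

  module ∑ = CMSum +-commutativeMonoid
  module Π = CMSum *-commutativeMonoid

  -- x ↦ x + 1# permutes F, so adding n · 1# to the sum of all elements changes nothing.
  order·1≈0 : n · 1# ≈ 0#
  order·1≈0 = identityʳ-unique S (n · 1#) (begin
    S + n · 1#                        ≈⟨ +-congˡ (∑.sum-replicate n) ⟨
    S + ∑.sum {n} (λ _ → 1#)          ≈⟨ ∑.∑-distrib-+ enum (λ _ → 1#) ⟨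
    ∑.sum (λ i → enum i + 1#)         ≈⟨ sum-∘-bijection (_+ 1#) (_- 1#) +-congʳ +-congʳ
                                           (//-rightDividesˡ 1#) (//-rightDividesʳ 1#)
                                           +-commutativeMonoid (λ x → x) (λ x≈y → x≈y) ⟩
    S                                 ∎)
    where S = ∑.sum enum
          open import Algebra.Properties.Group +-group using (//-rightDividesˡ; //-rightDividesʳ; loop)
          open import Algebra.Properties.Loop loop using (identityʳ-unique)

  order≡p^j⇒p·1≈0 : ∀ {p j} → n ≡ p ℕ.^ j → p · 1# ≈ 0#
  order≡p^j⇒p·1≈0 {p} {j} n≡p^j = ^≈0⇒≈0 j (begin
    (p · 1#) ^ j            ≈⟨ ·1-^ j ⟨
    (p ℕ.^ j) · 1#          ≡⟨ ≡.cong (_· 1#) n≡p^j ⟨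
    n · 1#                  ≈⟨ order·1≈0 ⟩
    0#                      ∎)
    where
      ·1-^ : ∀ j → (p ℕ.^ j) · 1# ≈ (p · 1#) ^ j
      ·1-^ zero    = +-identityʳ 1#
      ·1-^ (suc j) = trans (×1-homo-* p (p ℕ.^ j)) (*-congˡ (·1-^ j))

  ∏-const : ∀ k a → Π.sum {k} (λ _ → a) ≈ a ^ k
  ∏-const zero    a = refl
  ∏-const (suc k) a = *-congˡ (∏-const k a)

  ∏-except-one : ∀ {k} (t : Fin k → Carrier) (i : Fin k) {a} → t i ≈ 1# →
                 (∀ j → j ≢ i → t j ≈ a) → Π.sum t ≈ a ^ ℕ.pred k
  ∏-except-one {suc k} t i {a} tᵢ≈1 tⱼ≈a = begin
    Π.sum t                           ≈⟨ Π.sum-remove {i = i} t ⟩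
    t i * Π.sum (removeAt t i)        ≈⟨ *-cong tᵢ≈1 (Π.sum-cong-≋ {k} (λ j → tⱼ≈a _ (Fin.punchInᵢ≢i i j))) ⟩
    1# * Π.sum {k} (λ _ → a)          ≈⟨ *-identityˡ _ ⟩
    Π.sum {k} (λ _ → a)               ≈⟨ ∏-const k a ⟩
    a ^ k                             ∎
    where open import Data.Vec.Functional using (removeAt)

  ∏-nonzero : ∀ {k} {t : Fin k → Carrier} → (∀ i → t i ≉ 0#) → Π.sum t ≉ 0#
  ∏-nonzero {zero}  tᵢ≉0 = 1≉0
  ∏-nonzero {suc k} tᵢ≉0 = *-nonzero (tᵢ≉0 Fin.zero) (∏-nonzero (λ i → tᵢ≉0 (Fin.suc i)))

  unitPart : Carrier → Carrier
  unitPart x with x ≟ 0#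
  ... | yes _ = 1#
  ... | no  _ = x

  unitPart-nonzero : ∀ x → unitPart x ≉ 0#
  unitPart-nonzero x with x ≟ 0#
  ... | yes _   = 1≉0
  ... | no  x≉0 = x≉0

  unitPart-cong : ∀ {x y} → x ≈ y → unitPart x ≈ unitPart y
  unitPart-cong {x} {y} x≈y with x ≟ 0# | y ≟ 0#
  ... | yes _   | yes _   = refl
  ... | yes x≈0 | no  y≉0 = ⊥-elim (y≉0 (trans (sym x≈y) x≈0))
  ... | no  x≉0 | yes y≈0 = ⊥-elim (x≉0 (trans x≈y y≈0))
  ... | no  _   | no  _   = x≈y

  factorAt : Carrier → Carrier → Carrier
  factorAt a x with x ≟ 0#
  ... | yes _ = 1#
  ... | no  _ = a

  unitPart-* : ∀ {a} → a ≉ 0# → ∀ x → unitPart (a * x) ≈ factorAt a x * unitPart x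
  unitPart-* {a} a≉0 x with x ≟ 0# | a * x ≟ 0#
  ... | yes _   | yes _    = sym (*-identityˡ _)
  ... | yes x≈0 | no  ax≉0 = ⊥-elim (ax≉0 (trans (*-congˡ x≈0) (zeroʳ a)))
  ... | no  x≉0 | yes ax≈0 = ⊥-elim (*-nonzero a≉0 x≉0 ax≈0)
  ... | no  _   | no  _    = refl

  ∏-factorAt : ∀ a → Π.sum (λ i → factorAt a (enum i)) ≈ a ^ ℕ.pred n
  ∏-factorAt a = ∏-except-one _ (index 0#) at-zero elsewhere
    where
      at-zero : factorAt a (enum (index 0#)) ≈ 1#
      at-zero with enum (index 0#) ≟ 0#
      ... | yes _ = refl
      ... | no  e≉0 = ⊥-elim (e≉0 (enum-index 0#))
      elsewhere : ∀ j → j ≢ index 0# → factorAt a (enum j) ≈ a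
      elsewhere j j≢ with enum j ≟ 0#
      ... | yes e≈0 = ⊥-elim (j≢ (≡.trans (≡.sym (index-enum j)) (index-cong e≈0)))
      ... | no  _   = refl

  -- x ↦ a * x permutes F; replacing 0# by 1# keeps the product over all of F invertible.
  fermat-unit : ∀ {a} → a ≉ 0# → a ^ ℕ.pred n ≈ 1#
  fermat-unit {a} a≉0 = *-cancelˡ (∏-nonzero (λ i → unitPart-nonzero (enum i))) (begin
    P * a ^ ℕ.pred n                                ≈⟨ *-comm _ _ ⟩
    a ^ ℕ.pred n * P                                ≈⟨ *-congʳ (∏-factorAt a) ⟨
    Π.sum (λ i → factorAt a (enum i)) * P           ≈⟨ Π.∑-distrib-+ _ (λ i → unitPart (enum i)) ⟨
    Π.sum (λ i → factorAt a (enum i) * unitPart (enum i)) ≈⟨ Π.sum-cong-≋ {n} (λ i → unitPart-* a≉0 (enum i)) ⟨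
    Π.sum (λ i → unitPart (a * enum i))             ≈⟨ sum-∘-bijection (a *_) (a ⁻¹ *_) *-congˡ *-congˡ
                                                         (*-⁻¹-cancelˡ a≉0) (⁻¹-*-cancelˡ a≉0)
                                                         *-commutativeMonoid unitPart unitPart-cong ⟩
    P                                               ≈⟨ *-identityʳ P ⟨
    P * 1#                                          ∎)
    where P = Π.sum (λ i → unitPart (enum i))

  fermat : ∀ x → x ^ n ≈ x
  fermat x = trans (reflexive (≡.cong (x ^_) n≡1+pred)) (fermat′ (x ≟ 0#))
    where
      n≡1+pred : n ≡ suc (ℕ.pred n)
      n≡1+pred = ≡.sym (ℕ.suc-pred n {{Fin.nonZeroIndex (index 0#)}})
      fermat′ : Dec (x ≈ 0#) → x ^ suc (ℕ.pred n) ≈ x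
      fermat′ (yes x≈0) = trans (^-cong (suc (ℕ.pred n)) x≈0) (trans (zeroˡ _) (sym x≈0))
      fermat′ (no  x≉0) = trans (*-congˡ (fermat-unit x≉0)) (*-identityʳ x)

module PrimeBinomial {p : ℕ} (p-prime : Prime p) where
  open import Data.Nat.Divisibility using (_∣_; ∣1⇒≡1; ∣⇒≤; m∣m*n)
  open import Data.Nat.DivMod using (m/n*n≡m)
  open import Data.Nat.Combinatorics using (_C_; nCk≡n!/k![n-k]!; k![n∸k]!∣n!)
  open import Data.Nat using (_!; _<_; _∸_; _*_)
  open import Data.Nat.Properties using (_!*_!≢0)

  p∤m! : ∀ m → m < p → ¬ (p ∣ m !)
  p∤m! zero    _   p∣1 = ℕ.nonTrivial⇒≢1 {{prime⇒nonTrivial p-prime}} (∣1⇒≡1 p∣1)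
  p∤m! (suc m) m<p p∣m! with euclidsLemma (suc m) (m !) p-prime p∣m!
  ... | inj₁ p∣1+m = ℕ.<⇒≱ m<p (∣⇒≤ p∣1+m)
  ... | inj₂ p∣m!′ = p∤m! m (ℕ.<-trans (ℕ.n<1+n m) m<p) p∣m!′

  p∣pCk : ∀ {k} → 0 < k → k < p → p ∣ p C k
  p∣pCk {k} 0<k k<p with euclidsLemma (p C k) (k ! * (p ∸ k) !) p-prime p∣C*k!*[p-k]!
    where
      m∣m! : ∀ {m} → 0 < m → m ∣ m !
      m∣m! {suc m} _ = m∣m*n (m !)
      C*k!*[p-k]!≡p! : (p C k) * (k ! * (p ∸ k) !) ≡ p !
      C*k!*[p-k]!≡p! = ≡.trans (≡.cong (_* (k ! * (p ∸ k) !)) (nCk≡n!/k![n-k]! (ℕ.<⇒≤ k<p)))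
                               (m/n*n≡m {{k !* (p ∸ k) !≢0}} (k![n∸k]!∣n! (ℕ.<⇒≤ k<p)))
      p∣C*k!*[p-k]! : p ∣ (p C k) * (k ! * (p ∸ k) !)
      p∣C*k!*[p-k]! = ≡.subst (p ∣_) (≡.sym C*k!*[p-k]!≡p!) (m∣m! (ℕ.<-trans 0<k k<p))
  ... | inj₁ p∣C = p∣C
  ... | inj₂ p∣k!*[p-k]! with euclidsLemma (k !) ((p ∸ k) !) p-prime p∣k!*[p-k]!
  ...   | inj₁ p∣k!     = ⊥-elim (p∤m! k k<p p∣k!)
  ...   | inj₂ p∣[p-k]! = ⊥-elim (p∤m! (p ∸ k) (ℕ.∸-monoʳ-< 0<k (ℕ.<⇒≤ k<p)) p∣[p-k]!)

module Frobenius {c ℓ} (R : CommutativeRing c ℓ) where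
  open CommutativeRing R
  open import Algebra.Properties.Semiring.Mult semiring using (×-congʳ; ×-assoc-*; ×1-homo-*; ×-homo-1) renaming (_×_ to _·_)
  open import Algebra.Properties.Semiring.Exp semiring using (_^_; ^-congˡ; ^-assocʳ)
  open import Algebra.Properties.CommutativeSemiring.Binomial commutativeSemiring
    using (theorem; binomialTerm)
  import Algebra.Properties.Semiring.Sum semiring as ∑
  open import Data.Nat.Divisibility using (_∣_; divides)
  open import Data.Nat.Combinatorics using (_C_; nCn≡1)
  open import Relation.Binary.Reasoning.Setoid setoid

  inner-binomials-vanish⇒dream : ∀ n .{{_ : ℕ.NonZero n}} →
    (∀ {k} → 0 ℕ.< k → k ℕ.< n → ∀ z → (n C k) · z ≈ 0#) →
    ∀ x y → (x + y) ^ n ≈ x ^ n + y ^ n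
  inner-binomials-vanish⇒dream (suc m) inner≈0 x y = begin
    (x + y) ^ suc m                               ≈⟨ theorem (suc m) x y ⟩
    T Fin.zero + ∑.sum (λ j → T (Fin.suc j))      ≈⟨ +-congˡ (∑.sum-init-last (λ j → T (Fin.suc j))) ⟩
    T Fin.zero + (∑.sum (λ i → T (Fin.suc (Fin.inject₁ i))) + T (Fin.suc (Fin.fromℕ m)))
                                                  ≈⟨ +-congˡ (+-congʳ (trans (∑.sum-cong-≋ {m} inner) (∑.sum-replicate-zero m))) ⟩
    T Fin.zero + (0# + T (Fin.suc (Fin.fromℕ m))) ≈⟨ +-cong first (trans (+-identityˡ _) last) ⟩
    y ^ suc m + x ^ suc m                         ≈⟨ +-comm _ _ ⟩
    x ^ suc m + y ^ suc m                         ∎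
    where
      T = binomialTerm x y (suc m)
      inner : ∀ i → T (Fin.suc (Fin.inject₁ i)) ≈ 0#
      inner i = inner≈0 (ℕ.s≤s ℕ.z≤n) (ℕ.s≤s (Fin.inject₁ℕ< i)) _
      first : T Fin.zero ≈ y ^ suc m
      first = trans (×-homo-1 _) (*-identityˡ _)
      last : T (Fin.suc (Fin.fromℕ m)) ≈ x ^ suc m
      last = begin
        (suc m C suc (Fin.toℕ (Fin.fromℕ m))) · (x ^ suc (Fin.toℕ (Fin.fromℕ m)) * y ^ (m ℕ.∸ Fin.toℕ (Fin.fromℕ m)))
          ≡⟨ ≡.cong (λ k → (suc m C suc k) · (x ^ suc k * y ^ (m ℕ.∸ k))) (Fin.toℕ-fromℕ m) ⟩
        (suc m C suc m) · (x ^ suc m * y ^ (m ℕ.∸ m))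
          ≡⟨ ≡.cong₂ (λ c e → c · (x ^ suc m * y ^ e)) (nCn≡1 (suc m)) (ℕ.n∸n≡0 m) ⟩
        1 · (x ^ suc m * 1#)                      ≈⟨ ×-homo-1 _ ⟩
        x ^ suc m * 1#                            ≈⟨ *-identityʳ _ ⟩
        x ^ suc m                                 ∎

  module _ {p : ℕ} (p-prime : Prime p) (char-p : p · 1# ≈ 0#) where
    open PrimeBinomial p-prime using (p∣pCk)

    multiple-of-p·≈0 : ∀ m x → p ∣ m → m · x ≈ 0#
    multiple-of-p·≈0 m x p∣m = begin
      m · x            ≈⟨ ×-congʳ m (*-identityˡ x) ⟨
      m · (1# * x)     ≈⟨ ×-assoc-* m 1# x ⟨
      (m · 1#) * x     ≈⟨ *-congʳ (m·1≈0 p∣m) ⟩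
      0# * x           ≈⟨ zeroˡ x ⟩
      0#               ∎
      where
        m·1≈0 : ∀ {m} → p ∣ m → m · 1# ≈ 0#
        m·1≈0 (divides d ≡.refl) = begin
          (d ℕ.* p) · 1#      ≈⟨ ×1-homo-* d p ⟩
          (d · 1#) * (p · 1#) ≈⟨ *-congˡ char-p ⟩
          (d · 1#) * 0#       ≈⟨ zeroʳ _ ⟩
          0#                  ∎

    freshman's-dream : ∀ x y → (x + y) ^ p ≈ x ^ p + y ^ p
    freshman's-dream = inner-binomials-vanish⇒dream p {{prime⇒nonZero p-prime}}
      (λ 0<k k<p z → multiple-of-p·≈0 _ z (p∣pCk 0<k k<p))

    freshman's-dream-^ : ∀ k x y → (x + y) ^ (p ℕ.^ k) ≈ x ^ (p ℕ.^ k) + y ^ (p ℕ.^ k)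
    freshman's-dream-^ zero    x y = trans (*-identityʳ _) (+-cong (sym (*-identityʳ x)) (sym (*-identityʳ y)))
    freshman's-dream-^ (suc k) x y = begin
      (x + y) ^ (p ℕ.* p ℕ.^ k)              ≈⟨ ^-assocʳ (x + y) p (p ℕ.^ k) ⟨
      ((x + y) ^ p) ^ (p ℕ.^ k)              ≈⟨ ^-congˡ (p ℕ.^ k) (freshman's-dream x y) ⟩
      (x ^ p + y ^ p) ^ (p ℕ.^ k)            ≈⟨ freshman's-dream-^ k (x ^ p) (y ^ p) ⟩
      (x ^ p) ^ (p ℕ.^ k) + (y ^ p) ^ (p ℕ.^ k) ≈⟨ +-cong (^-assocʳ x p (p ℕ.^ k)) (^-assocʳ y p (p ℕ.^ k)) ⟩
      x ^ (p ℕ.* p ℕ.^ k) + y ^ (p ℕ.* p ℕ.^ k) ∎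

module PolynomialRoots {n : ℕ} (F : FiniteField n) where
  open FiniteField F
  open FieldProperties F
  open RingSolver cring using (solve; _:=_; _:+_; _:*_; _:-_; :-_; con)
  open import Data.Vec using (Vec; []; _∷_)
  open import Data.Vec.Relation.Unary.All as All using (All; []; _∷_)
  open import Algebra.Properties.Group +-group using (//-rightDividesʳ; x∙y⁻¹≈ε⇒x≈y)
  open import Relation.Binary.Reasoning.Setoid setoid

  eval : ∀ {k} → Vec Carrier k → Carrier → Carrier
  eval []       x = 0#
  eval (c ∷ cs) x = c + x * eval cs x

  -- synthetic division: the coefficients of (P(x) - P(a)) / (x - a), P = c ∷ cs
  quotient : ∀ {k} → Vec Carrier k → Carrier → Vec Carrier k
  quotient []       a = []
  quotient (c ∷ cs) a = eval (c ∷ cs) a ∷ quotient cs a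

  eval-division : ∀ {k} c (cs : Vec Carrier k) x a →
                  eval (c ∷ cs) x ≈ eval (c ∷ cs) a + (x - a) * eval (quotient cs a) x
  eval-division c []        x a = solve 3 (λ c x a → c :+ x :* con 0ℤ := (c :+ a :* con 0ℤ) :+ (x :- a) :* con 0ℤ) refl c x a
  eval-division c (c′ ∷ cs) x a = begin
    c + x * eval (c′ ∷ cs) x          ≈⟨ +-congˡ (*-congˡ (eval-division c′ cs x a)) ⟩
    c + x * (P′a + (x - a) * Q′x)
      ≈⟨ solve 5 (λ c x a P Q →
             c :+ x :* (P :+ (x :- a) :* Q)
           := (c :+ a :* P) :+ (x :- a) :* (P :+ x :* Q))
           refl c x a P′a Q′x ⟩
    (c + a * P′a) + (x - a) * (P′a + x * Q′x) ∎
    where P′a = eval (c′ ∷ cs) a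
          Q′x = eval (quotient cs a) x

  eval-zero : ∀ {k} {cs : Vec Carrier k} → All (_≈ 0#) cs → ∀ x → eval cs x ≈ 0#
  eval-zero []           x = refl
  eval-zero (c≈0 ∷ cs≈0) x = trans (+-cong c≈0 (trans (*-congˡ (eval-zero cs≈0 x)) (zeroʳ x))) (+-identityˡ 0#)

  constant-root : ∀ {k} c {cs : Vec Carrier k} a → All (_≈ 0#) cs → eval (c ∷ cs) a ≈ 0# → c ≈ 0#
  constant-root c a cs≈0 Pa≈0 =
    trans (sym (trans (+-congˡ (trans (*-congˡ (eval-zero cs≈0 a)) (zeroʳ a))) (+-identityʳ c))) Pa≈0

  quotient-zero : ∀ {k} (cs : Vec Carrier k) a → All (_≈ 0#) (quotient cs a) → All (_≈ 0#) cs
  quotient-zero []       a []          = []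
  quotient-zero (c ∷ cs) a (Pa≈0 ∷ Q≈0) = constant-root c a cs≈0 Pa≈0 ∷ cs≈0
    where cs≈0 = quotient-zero cs a Q≈0

  distinct-roots⇒zero : ∀ d (P : Vec Carrier (suc d)) (r : Fin (suc d) → Carrier) →
                        (∀ i j → r i ≈ r j → i ≡ j) → (∀ i → eval P (r i) ≈ 0#) → All (_≈ 0#) P
  distinct-roots⇒zero zero    (c ∷ [])  r _ roots = constant-root c (r Fin.zero) [] (roots Fin.zero) ∷ []
  distinct-roots⇒zero (suc d) (c ∷ cs) r r-inj roots = constant-root c a cs≈0 (roots Fin.zero) ∷ cs≈0
    where
      a = r Fin.zero
      quotient-roots : ∀ i → eval (quotient cs a) (r (Fin.suc i)) ≈ 0#
      quotient-roots i with *-integral {r (Fin.suc i) - a} (begin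
        (r (Fin.suc i) - a) * eval (quotient cs a) (r (Fin.suc i))  ≈⟨ //-rightDividesʳ _ _ ⟨
        _ + eval (c ∷ cs) a - eval (c ∷ cs) a                       ≈⟨ +-congʳ (+-comm _ _) ⟩
        eval (c ∷ cs) a + _ - eval (c ∷ cs) a                       ≈⟨ +-cong (sym (eval-division c cs _ a)) (-‿cong (roots Fin.zero)) ⟩
        eval (c ∷ cs) (r (Fin.suc i)) - 0#                          ≈⟨ +-cong (roots (Fin.suc i)) (-‿cong refl) ⟩
        0# - 0#                                                     ≈⟨ -‿inverseʳ 0# ⟩
        0#                                                          ∎)
      ... | inj₁ rᵢ-a≈0 = ⊥-elim (Fin.0≢1+n (≡.sym (r-inj _ _ (x∙y⁻¹≈ε⇒x≈y _ _ rᵢ-a≈0))))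
      ... | inj₂ Q≈0    = Q≈0
      cs≈0 : All (_≈ 0#) cs
      cs≈0 = quotient-zero cs a (distinct-roots⇒zero d (quotient cs a) (λ i → r (Fin.suc i))
               (λ i j e → Fin.suc-injective (r-inj _ _ e)) quotient-roots)

  monomial : ∀ k → Vec Carrier (suc k)
  monomial zero    = 1# ∷ []
  monomial (suc k) = 0# ∷ monomial k

  eval-monomial : ∀ k x → eval (monomial k) x ≈ x ^ k
  eval-monomial zero    x = trans (+-congˡ (zeroʳ x)) (+-identityʳ _)
  eval-monomial (suc k) x = trans (+-identityˡ _) (*-congˡ (eval-monomial k x))

  monomial-nonzero : ∀ k → ¬ All (_≈ 0#) (monomial k)
  monomial-nonzero zero    (1≈0 ∷ []) = 1≉0 1≈0
  monomial-nonzero (suc k) (_ ∷ m≈0)  = monomial-nonzero k m≈0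

  ¬∀x^d≈x : ∀ d → 2 ℕ.≤ d → d ℕ.< n → ¬ (∀ x → x ^ d ≈ x)
  ¬∀x^d≈x (suc zero)       (ℕ.s≤s ()) _
  ¬∀x^d≈x d@(suc (suc k)) _          d<n x^d≈x = monomial-nonzero k (All.tail (All.tail P≈0))
    where
      P : Vec Carrier (suc d)
      P = 0# ∷ - 1# ∷ monomial k
      eval-P : ∀ x → eval P x ≈ x ^ d - x
      eval-P x = begin
        0# + x * (- 1# + x * eval (monomial k) x) ≈⟨ +-congˡ (*-congˡ (+-congˡ (*-congˡ (eval-monomial k x)))) ⟩
        0# + x * (- 1# + x * x ^ k)
          ≈⟨ solve 2 (λ x y →
                 con 0ℤ :+ x :* (:- con 1ℤ :+ x :* y)
               := x :* (x :* y) :- x)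
               refl x (x ^ k) ⟩
        x ^ d - x                                 ∎
      r : Fin (suc d) → Carrier
      r i = enum (Fin.inject≤ i d<n)
      P≈0 : All (_≈ 0#) P
      P≈0 = distinct-roots⇒zero d P r
        (λ i j e → Fin.inject≤-injective d<n d<n i j (enum-injective _ _ e))
        (λ i → trans (eval-P (r i)) (trans (+-congʳ (x^d≈x (r i))) (-‿inverseʳ _)))

  ∃x^d≉x : ∀ d → 2 ℕ.≤ d → d ℕ.< n → ∃ λ x → x ^ d ≉ x
  ∃x^d≉x d 2≤d d<n = enum i , eᵢ^d≉eᵢ
    where
      ∃i : ∃ λ i → enum i ^ d ≉ enum i
      ∃i = Fin.¬∀⟶∃¬ n _ (λ i → enum i ^ d ≟ enum i) λ ∀i → ¬∀x^d≈x d 2≤d d<n λ x →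
             trans (^-cong d (sym (enum-index x))) (trans (∀i (index x)) (enum-index x))
      i = proj₁ ∃i
      eᵢ^d≉eᵢ = proj₂ ∃i

record Enumeration {n : ℕ} (P : Fin n → Set) : Set where
  field
    size     : ℕ
    element  : Fin size → Fin n
    injective : ∀ i j → element i ≡ element j → i ≡ j
    sound    : ∀ i → P (element i)
    complete : ∀ x → P x → ∃ λ i → element i ≡ x

enumerate : ∀ {n} {P : Fin n → Set} → (∀ x → Dec (P x)) → Enumeration P
enumerate {zero}  P? = record { size = 0 ; element = λ () ; injective = λ () ; sound = λ () ; complete = λ () }
enumerate {suc n} {P} P? with enumerate (λ x → P? (Fin.suc x)) | P? Fin.zero
... | E | no ¬P0 = record
  { size = size ; element = λ i → Fin.suc (element i)
  ; injective = λ i j e → injective i j (Fin.suc-injective e)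
  ; sound = sound
  ; complete = λ { Fin.zero P0 → ⊥-elim (¬P0 P0)
                 ; (Fin.suc x) Px → let (i , eᵢ≡x) = complete x Px in i , ≡.cong Fin.suc eᵢ≡x } }
  where open Enumeration E
... | E | yes P0 = record
  { size = suc size ; element = element′ ; injective = injective′ ; sound = sound′ ; complete = complete′ }
  where
    open Enumeration E
    element′ : Fin (suc size) → Fin (suc n)
    element′ Fin.zero    = Fin.zero
    element′ (Fin.suc i) = Fin.suc (element i)
    injective′ : ∀ i j → element′ i ≡ element′ j → i ≡ j
    injective′ Fin.zero    Fin.zero    _ = ≡.refl
    injective′ (Fin.suc i) (Fin.suc j) e = ≡.cong Fin.suc (injective i j (Fin.suc-injective e))
    sound′ : ∀ i → P (element′ i)
    sound′ Fin.zero    = P0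
    sound′ (Fin.suc i) = sound i
    complete′ : ∀ x → P x → ∃ λ i → element′ i ≡ x
    complete′ Fin.zero    _  = Fin.zero , ≡.refl
    complete′ (Fin.suc x) Px = let (i , eᵢ≡x) = complete x Px in Fin.suc i , ≡.cong Fin.suc eᵢ≡x

module AdditiveMaps {n : ℕ} (F : FiniteField n) where
  open FiniteField F
  open import Algebra.Properties.Group +-group using (//-rightDividesʳ; loop; inverseʳ-unique)
  open import Algebra.Properties.Loop loop using (identityʳ-unique)
  open import Algebra.Definitions _≈_ using (Congruent₁)
  open import Relation.Binary.Reasoning.Setoid setoid

  Additive : (Carrier → Carrier) → Set
  Additive f = ∀ x y → f (x + y) ≈ f x + f y

  additive-0 : ∀ {f} → Congruent₁ f → Additive f → f 0# ≈ 0#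
  additive-0 {f} f-cong f-+ = identityʳ-unique (f 0#) (f 0#) (trans (sym (f-+ 0# 0#)) (f-cong (+-identityʳ 0#)))

  additive-sub : ∀ {f} → Congruent₁ f → Additive f → ∀ x y → f (x - y) ≈ f x - f y
  additive-sub {f} f-cong f-+ x y = trans (f-+ x (- y)) (+-congˡ f-neg)
    where
      f-neg : f (- y) ≈ - f y
      f-neg = inverseʳ-unique (f y) (f (- y))
        (trans (sym (f-+ y (- y))) (trans (f-cong (-‿inverseʳ y)) (additive-0 f-cong f-+)))

  -- The key identity is T ∘ L⁻¹ ∘ f = T: f x determines T x, hence g (T x), hence x.
  module PermutationCriterion
    (T L L⁻¹ g : Carrier → Carrier)
    (T-cong : Congruent₁ T) (L-cong : Congruent₁ L) (L⁻¹-cong : Congruent₁ L⁻¹) (g-cong : Congruent₁ g)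
    (T-+ : Additive T) (L-+ : Additive L) (L⁻¹-+ : Additive L⁻¹)
    (L∘L⁻¹ : ∀ y → L (L⁻¹ y) ≈ y) (L⁻¹∘L : ∀ x → L⁻¹ (L x) ≈ x)
    (T∘L⁻¹∘g∘T≈0 : ∀ x → T (L⁻¹ (g (T x))) ≈ 0#) where

    f : Carrier → Carrier
    f x = g (T x) + L x

    L⁻¹∘f : ∀ x → L⁻¹ (f x) ≈ L⁻¹ (g (T x)) + x
    L⁻¹∘f x = trans (L⁻¹-+ (g (T x)) (L x)) (+-congˡ (L⁻¹∘L x))

    T∘L⁻¹∘f : ∀ x → T (L⁻¹ (f x)) ≈ T x
    T∘L⁻¹∘f x = trans (T-cong (L⁻¹∘f x)) (trans (T-+ _ _) (trans (+-congʳ (T∘L⁻¹∘g∘T≈0 x)) (+-identityˡ _)))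

    f-injective : ∀ x y → f x ≈ f y → x ≈ y
    f-injective x y fx≈fy = begin
      x                              ≈⟨ //-rightDividesʳ (L⁻¹ (g (T x))) x ⟨
      x + L⁻¹ (g (T x)) - L⁻¹ (g (T x)) ≈⟨ +-cong (trans (+-comm _ _) (sym (L⁻¹∘f x))) (-‿cong (L⁻¹-cong gTx≈gTy)) ⟩
      L⁻¹ (f x) - L⁻¹ (g (T y))      ≈⟨ +-congʳ (trans (L⁻¹-cong fx≈fy) (trans (L⁻¹∘f y) (+-comm _ _))) ⟩
      y + L⁻¹ (g (T y)) - L⁻¹ (g (T y)) ≈⟨ //-rightDividesʳ (L⁻¹ (g (T y))) y ⟩
      y                              ∎
      where
        gTx≈gTy : g (T x) ≈ g (T y)
        gTx≈gTy = g-cong (trans (sym (T∘L⁻¹∘f x)) (trans (T-cong (L⁻¹-cong fx≈fy)) (T∘L⁻¹∘f y)))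

    f-surjective : ∀ w → ∃ λ x → f x ≈ w
    f-surjective w = x , (begin
      g (T x) + L x                    ≈⟨ +-cong (g-cong Tx≈Tz) (additive-sub L-cong L-+ z _) ⟩
      g (T z) + (L z - L (L⁻¹ (g (T z)))) ≈⟨ +-congˡ (+-cong (L∘L⁻¹ w) (-‿cong (L∘L⁻¹ _))) ⟩
      g (T z) + (w - g (T z))          ≈⟨ +-congˡ (+-comm _ _) ⟩
      g (T z) + (- g (T z) + w)        ≈⟨ +-assoc _ _ _ ⟨
      g (T z) - g (T z) + w            ≈⟨ +-congʳ (-‿inverseʳ _) ⟩
      0# + w                           ≈⟨ +-identityˡ w ⟩
      w                                ∎)
      where
        z = L⁻¹ w
        x = z - L⁻¹ (g (T z))
        Tx≈Tz : T x ≈ T z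
        Tx≈Tz = begin
          T (z - L⁻¹ (g (T z)))        ≈⟨ additive-sub T-cong T-+ z _ ⟩
          T z - T (L⁻¹ (g (T z)))      ≈⟨ +-congˡ (-‿cong (T∘L⁻¹∘g∘T≈0 z)) ⟩
          T z - 0#                     ≈⟨ +-congˡ -0#≈0# ⟩
          T z + 0#                     ≈⟨ +-identityʳ _ ⟩
          T z                          ∎
          where open import Algebra.Properties.Ring ring using (-0#≈0#)

    f-bijective : IsBijective f
    f-bijective = f-injective , f-surjective

injection-avoiding : ∀ {s q} (j : Fin s) → q ℕ.≤ s →
  Σ (Fin (q ℕ.∸ 1) → Fin s) λ ρ → (∀ i i′ → ρ i ≡ ρ i′ → i ≡ i′) × (∀ i → ρ i ≢ j)
injection-avoiding {suc s} {q} j q≤1+s =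
  (λ i → Fin.punchIn j (Fin.inject≤ i q-1≤s)) ,
  (λ i i′ eq → Fin.inject≤-injective q-1≤s q-1≤s i i′ (Fin.punchIn-injective j _ _ eq)) ,
  (λ i → Fin.punchInᵢ≢i j _)
  where q-1≤s = ℕ.∸-monoˡ-≤ 1 q≤1+s

record NontrivialInvolution {n : ℕ} (F : FiniteField n) : Set where
  open FiniteField F
  field
    σ            : Carrier → Carrier
    σ-cong       : ∀ {x y} → x ≈ y → σ x ≈ σ y
    σ-+          : ∀ x y → σ (x + y) ≈ σ x + σ y
    σ-*          : ∀ x y → σ (x * y) ≈ σ x * σ y
    σ-involutive : ∀ x → σ (σ x) ≈ x
    θ            : Carrier
    σθ≉θ         : σ θ ≉ θ

module Conjugation {n : ℕ} {F : FiniteField n} (ι : NontrivialInvolution F) where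
  open FiniteField F
  open NontrivialInvolution ι
  open FieldProperties F
  open RingSolver cring using (solve; _:=_; _:+_; _:*_; _:-_; :-_; con)
  open import Algebra.Properties.Group +-group using (x∙y⁻¹≈ε⇒x≈y; //-rightDividesˡ; //-rightDividesʳ; loop)
  open import Algebra.Properties.Loop loop using (identityʳ-unique)
  open import Algebra.Properties.Ring ring using (-‿distribˡ-*; -1*x≈-x)
  open import Relation.Binary.Reasoning.Setoid setoid

  σ-0 : σ 0# ≈ 0#
  σ-0 = identityʳ-unique (σ 0#) (σ 0#) (trans (sym (σ-+ 0# 0#)) (σ-cong (+-identityʳ 0#)))

  σ-1 : σ 1# ≈ 1#
  σ-1 = begin
    σ 1#                 ≈⟨ *-identityʳ _ ⟨
    σ 1# * 1#            ≈⟨ *-congˡ (σ-involutive 1#) ⟨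
    σ 1# * σ (σ 1#)      ≈⟨ σ-* 1# (σ 1#) ⟨
    σ (1# * σ 1#)        ≈⟨ σ-cong (*-identityˡ _) ⟩
    σ (σ 1#)             ≈⟨ σ-involutive 1# ⟩
    1#                   ∎

  σ-neg : ∀ x → σ (- x) ≈ - σ x
  σ-neg x = begin
    σ (- x)                     ≈⟨ //-rightDividesʳ (σ x) _ ⟨
    σ (- x) + σ x - σ x         ≈⟨ +-congʳ (σ-+ (- x) x) ⟨
    σ (- x + x) - σ x           ≈⟨ +-congʳ (trans (σ-cong (-‿inverseˡ x)) σ-0) ⟩
    0# - σ x                    ≈⟨ +-identityˡ _ ⟩
    - σ x                       ∎

  σ-sub : ∀ x y → σ (x - y) ≈ σ x - σ y
  σ-sub x y = trans (σ-+ x (- y)) (+-congˡ (σ-neg y))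

  σ-^ : ∀ x m → σ (x ^ m) ≈ σ x ^ m
  σ-^ x zero    = σ-1
  σ-^ x (suc m) = trans (σ-* x (x ^ m)) (*-congˡ (σ-^ x m))

  σ-nonzero : ∀ {x} → x ≉ 0# → σ x ≉ 0#
  σ-nonzero {x} x≉0 σx≈0 = x≉0 (trans (sym (σ-involutive x)) (trans (σ-cong σx≈0) σ-0))

  Fixed : Carrier → Set
  Fixed x = σ x ≈ x

  norm : Carrier → Carrier
  norm x = x * σ x

  Fixed-* : ∀ {x y} → Fixed x → Fixed y → Fixed (x * y)
  Fixed-* σx≈x σy≈y = trans (σ-* _ _) (*-cong σx≈x σy≈y)

  Fixed-sub : ∀ {x y} → Fixed x → Fixed y → Fixed (x - y)
  Fixed-sub σx≈x σy≈y = trans (σ-sub _ _) (+-cong σx≈x (-‿cong σy≈y))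

  Fixed-⁻¹ : ∀ {x} → x ≉ 0# → Fixed x → Fixed (x ⁻¹)
  Fixed-⁻¹ {x} x≉0 σx≈x = *-cancelˡ x≉0 (begin
    x * σ (x ⁻¹)       ≈⟨ *-congʳ σx≈x ⟨
    σ x * σ (x ⁻¹)     ≈⟨ σ-* x (x ⁻¹) ⟨
    σ (x * x ⁻¹)       ≈⟨ σ-cong (*-inverseʳ x≉0) ⟩
    σ 1#               ≈⟨ σ-1 ⟩
    1#                 ≈⟨ *-inverseʳ x≉0 ⟨
    x * x ⁻¹           ∎)

  norm-neg : ∀ x → norm (- x) ≈ norm x
  norm-neg x = trans (*-congˡ (σ-neg x)) (solve 2 (λ x y → :- x :* :- y := x :* y) refl x (σ x))

  norm-σ : ∀ x → norm (σ x) ≈ norm x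
  norm-σ x = trans (*-congˡ (σ-involutive x)) (*-comm _ _)

  norm-^ : ∀ x m → norm (x ^ m) ≈ norm x ^ m
  norm-^ x m = trans (*-congˡ (σ-^ x m)) (sym (^-distribʳ-* x (σ x) m))

  norm-nonzero : ∀ {x} → x ≉ 0# → norm x ≉ 0#
  norm-nonzero x≉0 = *-nonzero x≉0 (σ-nonzero x≉0)

  trace : Carrier → Carrier
  trace x = x + σ x

  Fixed-trace : ∀ x → Fixed (trace x)
  Fixed-trace x = trans (σ-+ x (σ x)) (trans (+-congˡ (σ-involutive x)) (+-comm _ _))

  Fixed-norm : ∀ x → Fixed (norm x)
  Fixed-norm x = trans (σ-* x (σ x)) (trans (*-congˡ (σ-involutive x)) (*-comm _ _))

  hilbert90 : ∀ c → norm c ≈ 1# → ∃ λ b → b ≉ 0# × σ b ≈ c * b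
  hilbert90 c c·σc≈1 = choose (candidate 1# ≟ 0#)
    where
      candidate : Carrier → Carrier
      candidate x = σ x + σ c * x

      σ-candidate : ∀ x → σ (candidate x) ≈ c * candidate x
      σ-candidate x = begin
        σ (σ x + σ c * x)         ≈⟨ trans (σ-+ _ _) (+-cong (σ-involutive x) (trans (σ-* _ _) (*-congʳ (σ-involutive c)))) ⟩
        x + c * σ x               ≈⟨ +-congʳ (trans (*-congʳ c·σc≈1) (*-identityˡ x)) ⟨
        c * σ c * x + c * σ x     ≈⟨ solve 4 (λ c d x y → c :* d :* x :+ c :* y := c :* (y :+ d :* x)) refl c (σ c) x (σ x) ⟩
        c * (σ x + σ c * x)       ∎

      -- if candidate 1# vanishes then σ c ≈ - 1#, and candidate θ ≈ σ θ - θ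
      choose : Dec (candidate 1# ≈ 0#) → ∃ λ b → b ≉ 0# × σ b ≈ c * b
      choose (no  b≉0) = candidate 1# , b≉0 , σ-candidate 1#
      choose (yes b≈0) = candidate θ , candidate-θ≉0 , σ-candidate θ
        where
          σc≈-1 : σ c ≈ - 1#
          σc≈-1 = begin
            σ c                       ≈⟨ //-rightDividesʳ 1# _ ⟨
            σ c + 1# - 1#             ≈⟨ +-congʳ (trans (+-comm _ _) (+-cong (sym σ-1) (sym (*-identityʳ _)))) ⟩
            candidate 1# - 1#         ≈⟨ +-congʳ b≈0 ⟩
            0# - 1#                   ≈⟨ +-identityˡ _ ⟩
            - 1#                      ∎
          candidate-θ≉0 : candidate θ ≉ 0#
          candidate-θ≉0 bθ≈0 = σθ≉θ (x∙y⁻¹≈ε⇒x≈y _ _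
            (trans (+-congˡ (sym (trans (*-congʳ σc≈-1) (-1*x≈-x θ)))) bθ≈0))

  -- in characteristic 2 the trace of 1# vanishes, but then that of θ does not
  ∃trace≉0 : ∃ λ t → trace t ≉ 0#
  ∃trace≉0 with 1# + 1# ≟ 0#
  ... | no  2≉0 = 1# , λ tr≈0 → 2≉0 (trans (+-congˡ (sym σ-1)) tr≈0)
  ... | yes 2≈0 = θ , λ trθ≈0 → σθ≉θ (begin
    σ θ                   ≈⟨ solve 2 (λ t s → s := (t :+ s) :- t) refl θ (σ θ) ⟩
    (θ + σ θ) - θ         ≈⟨ +-congʳ trθ≈0 ⟩
    0# - θ                ≈⟨ +-congʳ (trans (sym (zeroˡ θ)) (*-congʳ (sym 2≈0))) ⟩
    (1# + 1#) * θ - θ     ≈⟨ solve 1 (λ t → (con 1ℤ :+ con 1ℤ) :* t :- t := t) refl θ ⟩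
    θ                     ∎)

  θ₁ : Carrier
  θ₁ = t * trace t ⁻¹
    where t = proj₁ ∃trace≉0

  trace-θ₁ : trace θ₁ ≈ 1#
  trace-θ₁ = begin
    t * trace t ⁻¹ + σ (t * trace t ⁻¹)    ≈⟨ +-congˡ (trans (σ-* _ _) (*-congˡ (Fixed-⁻¹ tr≉0 (Fixed-trace t)))) ⟩
    t * trace t ⁻¹ + σ t * trace t ⁻¹      ≈⟨ distribʳ _ _ _ ⟨
    trace t * trace t ⁻¹                   ≈⟨ *-inverseʳ tr≉0 ⟩
    1#                                     ∎
    where t = proj₁ ∃trace≉0
          tr≉0 = proj₂ ∃trace≉0

  ω : Carrier
  ω = σ θ - θ

  ω≉0 : ω ≉ 0#
  ω≉0 ω≈0 = σθ≉θ (x∙y⁻¹≈ε⇒x≈y _ _ ω≈0)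

  σ-ω : σ ω ≈ - ω
  σ-ω = begin
    σ (σ θ - θ)          ≈⟨ trans (σ-sub _ _) (+-congʳ (σ-involutive θ)) ⟩
    θ - σ θ              ≈⟨ solve 2 (λ t s → t :- s := :- (s :- t)) refl θ (σ θ) ⟩
    - (σ θ - θ)          ∎

  im re : Carrier → Carrier
  im y = (σ y - y) * ω ⁻¹
  re y = y - im y * θ

  im-*-ω : ∀ y → im y * ω ≈ σ y - y
  im-*-ω y = trans (*-assoc _ _ _) (trans (*-congˡ (*-inverseˡ ω≉0)) (*-identityʳ _))

  Fixed-im : ∀ y → Fixed (im y)
  Fixed-im y = *-cancelˡ ω≉0 (begin
    ω * σ (im y)             ≈⟨ solve 2 (λ w s → w :* s := :- (s :* (:- w))) refl ω (σ (im y)) ⟩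
    - (σ (im y) * - ω)       ≈⟨ -‿cong (*-congˡ σ-ω) ⟨
    - (σ (im y) * σ ω)       ≈⟨ -‿cong (σ-* _ _) ⟨
    - σ (im y * ω)           ≈⟨ -‿cong (σ-cong (im-*-ω y)) ⟩
    - σ (σ y - y)            ≈⟨ -‿cong (trans (σ-sub _ _) (+-congʳ (σ-involutive y))) ⟩
    - (y - σ y)              ≈⟨ solve 2 (λ a b → :- (a :- b) := b :- a) refl y (σ y) ⟩
    σ y - y                  ≈⟨ im-*-ω y ⟨
    im y * ω                 ≈⟨ *-comm _ _ ⟩
    ω * im y                 ∎)

  Fixed-re : ∀ y → Fixed (re y)
  Fixed-re y = x∙y⁻¹≈ε⇒x≈y _ _ (begin
    σ (y - b * θ) - (y - b * θ)   ≈⟨ +-congʳ (trans (σ-sub _ _) (+-congˡ (-‿cong (trans (σ-* b θ) (*-congʳ (Fixed-im y)))))) ⟩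
    (σ y - b * σ θ) - (y - b * θ)
      ≈⟨ solve 5 (λ y s b t u →
             (s :- b :* u) :- (y :- b :* t)
           := (s :- y) :- b :* (u :- t))
           refl y (σ y) b θ (σ θ) ⟩
    (σ y - y) - b * ω             ≈⟨ +-congˡ (-‿cong (im-*-ω y)) ⟩
    (σ y - y) - (σ y - y)         ≈⟨ -‿inverseʳ _ ⟩
    0#                            ∎)
    where b = im y

  re+im·θ : ∀ y → re y + im y * θ ≈ y
  re+im·θ y = //-rightDividesˡ (im y * θ) y

  fixed : Enumeration (λ i → Fixed (enum i))
  fixed = enumerate (λ i → σ (enum i) ≟ enum i)

  open Enumeration fixed using (size; element)

  fixedIndex : ∀ {x} → Fixed x → ∃ λ j → enum (element j) ≈ x
  fixedIndex {x} σx≈x =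
    let (j , eⱼ≡iₓ) = Enumeration.complete fixed (index x) (trans (σ-cong (enum-index x)) (trans σx≈x (sym (enum-index x))))
    in j , trans (reflexive (≡.cong enum eⱼ≡iₓ)) (enum-index x)

  coordinate : ∀ {x} → Fixed x → Fin size
  coordinate σx≈x = proj₁ (fixedIndex σx≈x)

  element-coordinate : ∀ {x} (σx≈x : Fixed x) → enum (element (coordinate σx≈x)) ≈ x
  element-coordinate σx≈x = proj₂ (fixedIndex σx≈x)

  -- y ↦ (re y , im y) is injective.
  order≤|Fixed|² : n ℕ.≤ size ℕ.* size
  order≤|Fixed|² = Fin.injective⇒≤ {f = coordinates} coordinates-injective
    where
      coordinates : Fin n → Fin (size ℕ.* size)
      coordinates i = Fin.combine (coordinate (Fixed-re (enum i))) (coordinate (Fixed-im (enum i)))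
      coordinates-injective : ∀ {i i′} → coordinates i ≡ coordinates i′ → i ≡ i′
      coordinates-injective {i} {i′} eq = enum-injective i i′ (begin
        enum i                                   ≈⟨ re+im·θ (enum i) ⟨
        re (enum i) + im (enum i) * θ            ≈⟨ +-cong (element-coordinate _) (*-congʳ (element-coordinate _)) ⟨
        enum (element a) + enum (element b) * θ  ≡⟨ ≡.cong₂ (λ a b → enum (element a) + enum (element b) * θ) a≡a′ b≡b′ ⟩
        enum (element a′) + enum (element b′) * θ ≈⟨ +-cong (element-coordinate _) (*-congʳ (element-coordinate _)) ⟩
        re (enum i′) + im (enum i′) * θ          ≈⟨ re+im·θ (enum i′) ⟩
        enum i′                                  ∎)
        where
          a = coordinate (Fixed-re (enum i))
          b = coordinate (Fixed-im (enum i))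
          a′ = coordinate (Fixed-re (enum i′))
          b′ = coordinate (Fixed-im (enum i′))
          a≡a′ = proj₁ (Fin.combine-injective a b a′ b′ eq)
          b≡b′ = proj₂ (Fin.combine-injective a b a′ b′ eq)

  module _ {q : ℕ} (n≡q*q : n ≡ q ℕ.* q) where

    q≤|Fixed| : q ℕ.≤ size
    q≤|Fixed| = ℕ.≮⇒≥ (λ s<q → ℕ.<⇒≱ (ℕ.*-mono-< s<q s<q) (≡.subst (ℕ._≤ size ℕ.* size) n≡q*q order≤|Fixed|²))

    fixedElements : DistinctElements q Fixed
    fixedElements = record
      { pick = λ i → enum (element (Fin.inject≤ i q≤|Fixed|))
      ; pick-injective = λ i j e → Fin.inject≤-injective q≤|Fixed| q≤|Fixed| i j
                                     (Enumeration.injective fixed _ _ (enum-injective _ _ e))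
      ; pick-valid = λ i → Enumeration.sound fixed _ }

    nonzeroFixedElements : DistinctElements (q ℕ.∸ 1) (λ x → Fixed x × x ≉ 0#)
    nonzeroFixedElements = record
      { pick = λ i → enum (element (ρ i))
      ; pick-injective = λ i j e → ρ-injective i j (Enumeration.injective fixed _ _ (enum-injective _ _ e))
      ; pick-valid = λ i → Enumeration.sound fixed _ , λ eᵢ≈0 → ρ≢0 i
          (Enumeration.injective fixed _ _ (enum-injective _ _ (trans eᵢ≈0 (sym (element-coordinate σ-0))))) }
      where
        ρ-avoiding = injection-avoiding {q = q} (coordinate σ-0) q≤|Fixed|
        ρ = proj₁ ρ-avoiding
        ρ-injective = proj₁ (proj₂ ρ-avoiding)
        ρ≢0 = proj₂ (proj₂ ρ-avoiding)

  module LinearizedPolynomial (α₀ α₁ : Carrier) where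
    open AdditiveMaps F using (Additive)

    L : Carrier → Carrier
    L x = α₁ * σ x + α₀ * x

    L-cong : ∀ {x y} → x ≈ y → L x ≈ L y
    L-cong x≈y = +-cong (*-congˡ (σ-cong x≈y)) (*-congˡ x≈y)

    L-+ : Additive L
    L-+ x y = begin
      α₁ * σ (x + y) + α₀ * (x + y)      ≈⟨ +-congʳ (*-congˡ (σ-+ x y)) ⟩
      α₁ * (σ x + σ y) + α₀ * (x + y)
        ≈⟨ solve 6 (λ a b x y u v →
               a :* (u :+ v) :+ b :* (x :+ y)
             := (a :* u :+ b :* x) :+ (a :* v :+ b :* y))
             refl α₁ α₀ x y (σ x) (σ y) ⟩
      L x + L y                          ∎

    D : Carrier
    D = norm α₀ - norm α₁

    Fixed-D : Fixed D
    Fixed-D = Fixed-sub (Fixed-norm α₀) (Fixed-norm α₁)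

    -- Applying σ to L x = y gives σ α₁ * x + σ α₀ * σ x = σ y; solve this 2 × 2 system in
    -- (x , σ x), whose determinant is D.
    module _ (D≉0 : D ≉ 0#) where

      L⁻¹ : Carrier → Carrier
      L⁻¹ y = (σ α₀ * y - α₁ * σ y) * D ⁻¹

      L⁻¹-cong : ∀ {x y} → x ≈ y → L⁻¹ x ≈ L⁻¹ y
      L⁻¹-cong x≈y = *-congʳ (+-cong (*-congˡ x≈y) (-‿cong (*-congˡ (σ-cong x≈y))))

      L⁻¹-+ : Additive L⁻¹
      L⁻¹-+ y z = begin
        (σ α₀ * (y + z) - α₁ * σ (y + z)) * D ⁻¹   ≈⟨ *-congʳ (+-congˡ (-‿cong (*-congˡ (σ-+ y z)))) ⟩
        (σ α₀ * (y + z) - α₁ * (σ y + σ z)) * D ⁻¹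
          ≈⟨ solve 7 (λ a b y z u v i →
                 (a :* (y :+ z) :- b :* (u :+ v)) :* i
               := (a :* y :- b :* u) :* i :+ (a :* z :- b :* v) :* i)
               refl (σ α₀) α₁ y z (σ y) (σ z) (D ⁻¹) ⟩
        L⁻¹ y + L⁻¹ z                              ∎

      σ-L⁻¹ : ∀ y → σ (L⁻¹ y) ≈ (α₀ * σ y - σ α₁ * y) * D ⁻¹
      σ-L⁻¹ y = begin
        σ ((σ α₀ * y - α₁ * σ y) * D ⁻¹)           ≈⟨ σ-* _ _ ⟩
        σ (σ α₀ * y - α₁ * σ y) * σ (D ⁻¹)         ≈⟨ *-cong (σ-sub _ _) (Fixed-⁻¹ D≉0 Fixed-D) ⟩
        (σ (σ α₀ * y) - σ (α₁ * σ y)) * D ⁻¹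
          ≈⟨ *-congʳ (+-cong (trans (σ-* _ _) (*-congʳ (σ-involutive α₀))) (-‿cong (trans (σ-* _ _) (*-congˡ (σ-involutive y))))) ⟩
        (α₀ * σ y - σ α₁ * y) * D ⁻¹               ∎

      L∘L⁻¹ : ∀ y → L (L⁻¹ y) ≈ y
      L∘L⁻¹ y = begin
        α₁ * σ (L⁻¹ y) + α₀ * L⁻¹ y                ≈⟨ +-congʳ (*-congˡ (σ-L⁻¹ y)) ⟩
        α₁ * ((α₀ * σ y - σ α₁ * y) * D ⁻¹) + α₀ * ((σ α₀ * y - α₁ * σ y) * D ⁻¹)
          ≈⟨ solve 7 (λ a b a′ b′ y u i →
                 b :* ((a :* u :- b′ :* y) :* i) :+ a :* ((a′ :* y :- b :* u) :* i)
               := (a :* a′ :- b :* b′) :* i :* y)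
               refl α₀ α₁ (σ α₀) (σ α₁) y (σ y) (D ⁻¹) ⟩
        D * D ⁻¹ * y                               ≈⟨ *-congʳ (*-inverseʳ D≉0) ⟩
        1# * y                                     ≈⟨ *-identityˡ y ⟩
        y                                          ∎

      L⁻¹∘L : ∀ x → L⁻¹ (L x) ≈ x
      L⁻¹∘L x = begin
        (σ α₀ * L x - α₁ * σ (L x)) * D ⁻¹         ≈⟨ *-congʳ (+-congˡ (-‿cong (*-congˡ σ-L))) ⟩
        (σ α₀ * (α₁ * σ x + α₀ * x) - α₁ * (σ α₁ * x + σ α₀ * σ x)) * D ⁻¹
          ≈⟨ solve 7 (λ a b a′ b′ x u i →
                 (a′ :* (b :* u :+ a :* x) :- b :* (b′ :* x :+ a′ :* u)) :* i
               := (a :* a′ :- b :* b′) :* i :* x)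
               refl α₀ α₁ (σ α₀) (σ α₁) x (σ x) (D ⁻¹) ⟩
        D * D ⁻¹ * x                               ≈⟨ *-congʳ (*-inverseʳ D≉0) ⟩
        1# * x                                     ≈⟨ *-identityˡ x ⟩
        x                                          ∎
        where
          σ-L : σ (L x) ≈ σ α₁ * x + σ α₀ * σ x
          σ-L = trans (σ-+ _ _) (+-cong (trans (σ-* _ _) (*-congˡ (σ-involutive x))) (σ-* _ _))

  module ConjugateShift (δ : Carrier) (norm-δ : norm δ ≈ 1#) where
    open AdditiveMaps F using (Additive; module PermutationCriterion)

    δ≉0 : δ ≉ 0#
    δ≉0 δ≈0 = 1≉0 (trans (sym norm-δ) (trans (*-congʳ δ≈0) (zeroˡ _)))

    T : Carrier → Carrier
    T x = σ x + δ * x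

    T-cong : ∀ {x y} → x ≈ y → T x ≈ T y
    T-cong x≈y = +-cong (σ-cong x≈y) (*-congˡ x≈y)

    T-+ : Additive T
    T-+ x y = trans (+-cong (σ-+ x y) (distribˡ δ x y))
      (solve 4 (λ a b c d → (a :+ b) :+ (c :+ d) := (a :+ c) :+ (b :+ d)) refl (σ x) (σ y) (δ * x) (δ * y))

    σ-T : ∀ x → σ (T x) ≈ σ δ * T x
    σ-T x = begin
      σ (σ x + δ * x)               ≈⟨ trans (σ-+ _ _) (+-cong (σ-involutive x) (σ-* δ x)) ⟩
      x + σ δ * σ x                 ≈⟨ +-congʳ (trans (*-congʳ (trans (*-comm _ _) norm-δ)) (*-identityˡ x)) ⟨
      σ δ * δ * x + σ δ * σ x       ≈⟨ solve 4 (λ d e x u → d :* e :* x :+ d :* u := d :* (u :+ e :* x)) refl (σ δ) δ x (σ x) ⟩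
      σ δ * (σ x + δ * x)           ∎

    norm-σδ^[m+1] : ∀ m → norm (- (σ δ ^ suc m)) ≈ 1#
    norm-σδ^[m+1] m = begin
      norm (- (σ δ ^ suc m))        ≈⟨ norm-neg _ ⟩
      norm (σ δ ^ suc m)          ≈⟨ norm-^ (σ δ) (suc m) ⟩
      norm (σ δ) ^ suc m          ≈⟨ ^-cong (suc m) (trans (norm-σ δ) norm-δ) ⟩
      1# ^ suc m                  ≈⟨ 1^m≈1 (suc m) ⟩
      1#                          ∎

    σ-T^m : ∀ m x → σ (T x ^ m) ≈ σ δ ^ m * T x ^ m
    σ-T^m m x = trans (σ-^ (T x) m) (trans (^-cong m (σ-T x)) (^-distribʳ-* (σ δ) (T x) m))

    T-0 : T 0# ≈ 0#
    T-0 = trans (+-cong σ-0 (zeroʳ δ)) (+-identityʳ 0#)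

    T^m+L-0 : ∀ {m} → 1 ℕ.≤ m → ∀ α₀ α₁ → T 0# ^ m + LinearizedPolynomial.L α₀ α₁ 0# ≈ 0#
    T^m+L-0 {suc m} _ α₀ α₁ = begin
      T 0# * T 0# ^ m + (α₁ * σ 0# + α₀ * 0#)
        ≈⟨ +-cong (trans (*-congʳ T-0) (zeroˡ _)) (+-cong (trans (*-congˡ σ-0) (zeroʳ α₁)) (zeroʳ α₀)) ⟩
      0# + (0# + 0#)                          ≈⟨ trans (+-identityˡ _) (+-identityˡ 0#) ⟩
      0#                                      ∎

    norm-shift : ∀ a β → norm (δ * a + β) - norm a ≈ trace (δ * σ β * a) + norm β
    norm-shift a β = begin
      (δ * a + β) * σ (δ * a + β) - a * σ a       ≈⟨ +-congʳ (*-congˡ (trans (σ-+ _ _) (+-congʳ (σ-* δ a)))) ⟩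
      (δ * a + β) * (σ δ * σ a + σ β) - a * σ a
        ≈⟨ solve 6 (λ d e a u b v →
               (d :* a :+ b) :* (e :* u :+ v) :- a :* u
             := (d :* e :- con 1ℤ) :* (a :* u) :+ ((d :* v :* a :+ e :* b :* u) :+ b :* v))
             refl δ (σ δ) a (σ a) β (σ β) ⟩
      (δ * σ δ - 1#) * (a * σ a) + ((δ * σ β * a + σ δ * β * σ a) + norm β)
        ≈⟨ +-cong (trans (*-congʳ (trans (+-congʳ norm-δ) (-‿inverseʳ 1#))) (zeroˡ _)) (+-congʳ (+-congˡ σ-δσβa)) ⟩
      0# + (trace (δ * σ β * a) + norm β)         ≈⟨ +-identityˡ _ ⟩
      trace (δ * σ β * a) + norm β                ∎
      where
        σ-δσβa : σ δ * β * σ a ≈ σ (δ * σ β * a)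
        σ-δσβa = sym (trans (σ-* _ _) (*-congʳ (trans (σ-* _ _) (*-congˡ (σ-involutive β)))))

    module _ (m : ℕ) (α₀ α₁ : Carrier) (D≉0 : LinearizedPolynomial.D α₀ α₁ ≉ 0#)
             (σβ≈-σδ^[m+1]β : σ (α₀ - δ * α₁) ≈ - (σ δ ^ suc m) * (α₀ - δ * α₁)) where

      open LinearizedPolynomial α₀ α₁

      T∘L⁻¹-vanishes : ∀ h → σ h ≈ σ δ ^ m * h → T (L⁻¹ D≉0 h) ≈ 0#
      T∘L⁻¹-vanishes h σh≈εh = begin
        σ (L⁻¹ D≉0 h) + δ * L⁻¹ D≉0 h
          ≈⟨ +-cong (trans (σ-L⁻¹ D≉0 h) (*-congʳ (+-congʳ (*-congˡ σh≈εh))))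
                    (*-congˡ (*-congʳ (+-congˡ (-‿cong (*-congˡ σh≈εh))))) ⟩
        (α₀ * (ε * h) - σ α₁ * h) * D ⁻¹ + δ * ((σ α₀ * h - α₁ * (ε * h)) * D ⁻¹)
          ≈⟨ solve 8 (λ a b a′ b′ e h i d →
                 (a :* (e :* h) :- b′ :* h) :* i :+ d :* ((a′ :* h :- b :* (e :* h)) :* i)
               := (e :* (a :- d :* b) :+ (d :* a′ :- b′)) :* h :* i)
               refl α₀ α₁ (σ α₀) (σ α₁) ε h (D ⁻¹) δ ⟩
        (ε * β + (δ * σ α₀ - σ α₁)) * h * D ⁻¹  ≈⟨ *-congʳ (*-congʳ (+-congˡ (trans (sym δσβ≈δσα₀-σα₁) δσβ≈-εβ))) ⟩
        (ε * β - ε * β) * h * D ⁻¹              ≈⟨ *-congʳ (*-congʳ (-‿inverseʳ _)) ⟩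
        0# * h * D ⁻¹                          ≈⟨ trans (*-congʳ (zeroˡ h)) (zeroˡ _) ⟩
        0#                                     ∎
        where
          β = α₀ - δ * α₁
          ε = σ δ ^ m
          δσβ≈δσα₀-σα₁ : δ * σ β ≈ δ * σ α₀ - σ α₁
          δσβ≈δσα₀-σα₁ = begin
            δ * σ (α₀ - δ * α₁)            ≈⟨ *-congˡ (trans (σ-sub _ _) (+-congˡ (-‿cong (σ-* δ α₁)))) ⟩
            δ * (σ α₀ - σ δ * σ α₁)
              ≈⟨ solve 4 (λ d a e b →
                     d :* (a :- e :* b)
                   := d :* a :- (d :* e) :* b)
                   refl δ (σ α₀) (σ δ) (σ α₁) ⟩
            δ * σ α₀ - δ * σ δ * σ α₁      ≈⟨ +-congˡ (-‿cong (trans (*-congʳ norm-δ) (*-identityˡ _))) ⟩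
            δ * σ α₀ - σ α₁                ∎
          δσβ≈-εβ : δ * σ β ≈ - (ε * β)
          δσβ≈-εβ = begin
            δ * σ β                        ≈⟨ *-congˡ σβ≈-σδ^[m+1]β ⟩
            δ * (- (σ δ * ε) * β)          ≈⟨ solve 4 (λ d e m b → d :* (:- (e :* m) :* b) := :- ((d :* e) :* m :* b)) refl δ (σ δ) ε β ⟩
            - (δ * σ δ * ε * β)            ≈⟨ -‿cong (*-congʳ (trans (*-congʳ norm-δ) (*-identityˡ _))) ⟩
            - (ε * β)                      ∎

      T^m+L-bijective : IsBijective (λ x → T x ^ m + L x)
      T^m+L-bijective = PermutationCriterion.f-bijective T L (L⁻¹ D≉0) (_^ m)
        T-cong L-cong (L⁻¹-cong D≉0) (^-cong m) T-+ L-+ (L⁻¹-+ D≉0) (L∘L⁻¹ D≉0) (L⁻¹∘L D≉0)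
        (λ x → T∘L⁻¹-vanishes _ (σ-T^m m x))

    module PermutationFamily (m : ℕ) {a r : ℕ}
      (K : DistinctElements a Fixed) (U : DistinctElements r (λ x → Fixed x × x ≉ 0#)) where
      open DistinctElements K renaming (pick to κ; pick-injective to κ-injective; pick-valid to Fixed-κ)
      open DistinctElements U renaming (pick to μ; pick-injective to μ-injective; pick-valid to μ-valid)

      -- The β allowed by T∘L⁻¹-vanishes form the line b · F_q.
      b : Carrier
      b = proj₁ (hilbert90 (- (σ δ ^ suc m)) (norm-σδ^[m+1] m))

      b≉0 : b ≉ 0#
      b≉0 = proj₁ (proj₂ (hilbert90 (- (σ δ ^ suc m)) (norm-σδ^[m+1] m)))

      σ-b : σ b ≈ - (σ δ ^ suc m) * b
      σ-b = proj₂ (proj₂ (hilbert90 (- (σ δ ^ suc m)) (norm-σδ^[m+1] m)))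

      β : Fin r → Carrier
      β u = b * μ u

      β≉0 : ∀ u → β u ≉ 0#
      β≉0 u = *-nonzero b≉0 (proj₂ (μ-valid u))

      σ-β : ∀ u → σ (β u) ≈ - (σ δ ^ suc m) * β u
      σ-β u = trans (σ-* b (μ u)) (trans (*-cong σ-b (proj₁ (μ-valid u))) (*-assoc _ _ _))

      -- the trace of γ is prescribed by v, its trace-zero part κ k * ω by k
      γ : Fin a → Fin r → Fin r → Carrier
      γ k u v = norm (β u) * (μ v - 1#) * θ₁ + κ k * ω

      α₀ α₁ : Fin a → Fin r → Fin r → Carrier
      α₁ k u v = γ k u v * (δ * σ (β u)) ⁻¹
      α₀ k u v = δ * α₁ k u v + β u

      α₀-δα₁ : ∀ k u v → α₀ k u v - δ * α₁ k u v ≈ β u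
      α₀-δα₁ k u v = solve 2 (λ a b → (a :+ b) :- a := b) refl (δ * α₁ k u v) (β u)

      δσβα₁ : ∀ k u v → δ * σ (β u) * α₁ k u v ≈ γ k u v
      δσβα₁ k u v = trans (*-comm _ _) (trans (*-assoc _ _ _) (trans (*-congˡ (*-inverseˡ e≉0)) (*-identityʳ _)))
        where e≉0 = *-nonzero δ≉0 (σ-nonzero (β≉0 u))

      trace-γ : ∀ k u v → trace (γ k u v) ≈ norm (β u) * (μ v - 1#)
      trace-γ k u v = begin
        γ k u v + σ (ν * w * θ₁ + κ k * ω)
          ≈⟨ +-congˡ (trans (σ-+ _ _) (+-cong (trans (σ-* _ _) (*-congʳ Fixed-νw)) (trans (σ-* _ _) (*-cong (Fixed-κ k) σ-ω)))) ⟩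
        γ k u v + (ν * w * σ θ₁ + κ k * - ω)
          ≈⟨ solve 5 (λ w t s k o →
                 (w :* t :+ k :* o) :+ (w :* s :+ k :* (:- o))
               := w :* (t :+ s))
               refl (ν * w) θ₁ (σ θ₁) (κ k) ω ⟩
        ν * w * trace θ₁                     ≈⟨ *-congˡ trace-θ₁ ⟩
        ν * w * 1#                           ≈⟨ *-identityʳ _ ⟩
        ν * w                                ∎
        where
          ν = norm (β u)
          w = μ v - 1#
          Fixed-νw : Fixed (ν * w)
          Fixed-νw = Fixed-* (Fixed-norm (β u)) (Fixed-sub (proj₁ (μ-valid v)) σ-1)

      D≈νμ : ∀ k u v → norm (α₀ k u v) - norm (α₁ k u v) ≈ norm (β u) * μ v
      D≈νμ k u v = begin
        norm (δ * α₁ k u v + β u) - norm (α₁ k u v)     ≈⟨ norm-shift (α₁ k u v) (β u) ⟩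
        trace (δ * σ (β u) * α₁ k u v) + norm (β u)     ≈⟨ +-congʳ (trans (+-cong (δσβα₁ k u v) (σ-cong (δσβα₁ k u v))) (trace-γ k u v)) ⟩
        norm (β u) * (μ v - 1#) + norm (β u)          ≈⟨ solve 2 (λ n v → n :* (v :- con 1ℤ) :+ n := n :* v) refl (norm (β u)) (μ v) ⟩
        norm (β u) * μ v                              ∎

      module _ (k : Fin a) (u v : Fin r) where
        open LinearizedPolynomial (α₀ k u v) (α₁ k u v)

        D≉0 : D ≉ 0#
        D≉0 D≈0 = *-nonzero (norm-nonzero (β≉0 u)) (proj₂ (μ-valid v)) (trans (sym (D≈νμ k u v)) D≈0)

        L-surjective : ∀ y → ∃ λ x → L x ≈ y
        L-surjective y = L⁻¹ D≉0 y , L∘L⁻¹ D≉0 y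

        T^m+L-permutation : IsBijective (λ x → T x ^ m + L x)
        T^m+L-permutation = T^m+L-bijective m (α₀ k u v) (α₁ k u v) D≉0
          (trans (σ-cong (α₀-δα₁ k u v)) (trans (σ-β u) (*-congˡ (sym (α₀-δα₁ k u v)))))

      u-determined : ∀ {k u v k′ u′ v′} → α₀ k u v ≈ α₀ k′ u′ v′ → α₁ k u v ≈ α₁ k′ u′ v′ → u ≡ u′
      u-determined {k} {u} {v} {k′} {u′} {v′} e₀ e₁ = μ-injective u u′ (*-cancelˡ b≉0 (begin
        β u                          ≈⟨ α₀-δα₁ k u v ⟨
        α₀ k u v - δ * α₁ k u v      ≈⟨ +-cong e₀ (-‿cong (*-congˡ e₁)) ⟩
        α₀ k′ u′ v′ - δ * α₁ k′ u′ v′ ≈⟨ α₀-δα₁ k′ u′ v′ ⟩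
        β u′                         ∎))

      γ-determined : ∀ {k v k′ v′} u → α₁ k u v ≈ α₁ k′ u v′ → γ k u v ≈ γ k′ u v′
      γ-determined {k} {v} {k′} {v′} u e₁ = trans (sym (δσβα₁ k u v)) (trans (*-congˡ e₁) (δσβα₁ k′ u v′))

      v-determined : ∀ {k v k′ v′} u → γ k u v ≈ γ k′ u v′ → v ≡ v′
      v-determined {k} {v} {k′} {v′} u eγ = μ-injective v v′ (begin
        μ v                          ≈⟨ //-rightDividesˡ 1# (μ v) ⟨
        μ v - 1# + 1#                ≈⟨ +-congʳ (*-cancelˡ (norm-nonzero (β≉0 u)) (begin
          norm (β u) * (μ v - 1#)    ≈⟨ trace-γ k u v ⟨
          trace (γ k u v)            ≈⟨ +-cong eγ (σ-cong eγ) ⟩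
          trace (γ k′ u v′)          ≈⟨ trace-γ k′ u v′ ⟩
          norm (β u) * (μ v′ - 1#)   ∎)) ⟩
        μ v′ - 1# + 1#               ≈⟨ //-rightDividesˡ 1# (μ v′) ⟩
        μ v′                         ∎)

      κ-determined : ∀ {k k′ v v′} u → γ k u v ≈ γ k′ u v′ → v ≡ v′ → k ≡ k′
      κ-determined {k} {k′} {v} u eγ ≡.refl = κ-injective k k′ (*-cancelˡ ω≉0 (begin
        ω * κ k                      ≈⟨ *-comm _ _ ⟩
        κ k * ω                      ≈⟨ solve 2 (λ t g → g := (t :+ g) :- t) refl t (κ k * ω) ⟩
        γ k u v - t                  ≈⟨ +-congʳ eγ ⟩
        γ k′ u v - t                 ≈⟨ solve 2 (λ t g → (t :+ g) :- t := g) refl t (κ k′ * ω) ⟩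
        κ k′ * ω                     ≈⟨ *-comm _ _ ⟩
        ω * κ k′                     ∎))
        where t = norm (β u) * (μ v - 1#) * θ₁

      α-injective : ∀ {k u v k′ u′ v′} → α₀ k u v ≈ α₀ k′ u′ v′ → α₁ k u v ≈ α₁ k′ u′ v′ →
                    (k , u , v) ≡ (k′ , u′ , v′)
      α-injective {k} {u} {v} {k′} {u′} {v′} e₀ e₁ = same-u (u-determined e₀ e₁) e₁
        where
          same-u : u ≡ u′ → α₁ k u v ≈ α₁ k′ u′ v′ → (k , u , v) ≡ (k′ , u′ , v′)
          same-u ≡.refl e₁ = ≡.cong₂ (λ k v → k , u , v) (κ-determined u eγ v≡v′) v≡v′
            where eγ = γ-determined u e₁
                  v≡v′ = v-determined u eγ

module QuadraticExtension {q : ℕ} (q-prime-power : IsPrimePower q) (2≤q : 2 ℕ.≤ q)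
                               (F : FiniteField (q ℕ.^ 2)) where
  open FiniteField F
  open FieldProperties F
  open FiniteFieldCounting F using (order≡p^j⇒p·1≈0; fermat)
  open PolynomialRoots F using (∃x^d≉x)
  open Frobenius cring using (freshman's-dream-^)
  open import Algebra.Properties.Semiring.Exp semiring using () renaming (_^_ to _^ᴿ_)
  open import Algebra.Properties.Semiring.Mult semiring using () renaming (_×_ to _·_)
  open import Relation.Binary.Reasoning.Setoid setoid

  p k : ℕ
  p = proj₁ q-prime-power
  k = proj₁ (proj₂ q-prime-power)

  p-prime : Prime p
  p-prime = proj₁ (proj₂ (proj₂ q-prime-power))

  q≡p^k : q ≡ p ℕ.^ k
  q≡p^k = proj₂ (proj₂ (proj₂ (proj₂ q-prime-power)))

  char-p : p · 1# ≈ 0#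
  char-p = order≡p^j⇒p·1≈0 {p} {k ℕ.* 2} (≡.trans (≡.cong (ℕ._^ 2) q≡p^k) (ℕ.^-*-assoc p k 2))

  q^2≡q*q : q ℕ.^ 2 ≡ q ℕ.* q
  q^2≡q*q = ≡.cong (q ℕ.*_) (ℕ.*-identityʳ q)

  ^≈^ᴿ : ∀ x m → x ^ m ≈ x ^ᴿ m
  ^≈^ᴿ x zero    = refl
  ^≈^ᴿ x (suc m) = *-congˡ (^≈^ᴿ x m)

  frobenius-+ : ∀ x y → (x + y) ^ q ≈ x ^ q + y ^ q
  frobenius-+ x y = ≡.subst (λ e → (x + y) ^ e ≈ x ^ e + y ^ e) (≡.sym q≡p^k) (begin
    (x + y) ^ (p ℕ.^ k)             ≈⟨ ^≈^ᴿ (x + y) (p ℕ.^ k) ⟩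
    (x + y) ^ᴿ (p ℕ.^ k)            ≈⟨ freshman's-dream-^ p-prime char-p k x y ⟩
    x ^ᴿ (p ℕ.^ k) + y ^ᴿ (p ℕ.^ k) ≈⟨ +-cong (^≈^ᴿ x (p ℕ.^ k)) (^≈^ᴿ y (p ℕ.^ k)) ⟨
    x ^ (p ℕ.^ k) + y ^ (p ℕ.^ k)   ∎)

  frobenius-involutive : ∀ x → (x ^ q) ^ q ≈ x
  frobenius-involutive x = begin
    (x ^ q) ^ q         ≈⟨ ^-*-assoc x q q ⟩
    x ^ (q ℕ.* q)       ≡⟨ ≡.cong (x ^_) q^2≡q*q ⟨
    x ^ (q ℕ.^ 2)       ≈⟨ fermat x ⟩
    x                   ∎

  ∃θ^q≉θ : ∃ λ θ → θ ^ q ≉ θ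
  ∃θ^q≉θ = ∃x^d≉x q 2≤q (≡.subst (q ℕ.<_) (≡.sym q^2≡q*q) (ℕ.m<m*n q q 2≤q))
    where instance _ = ℕ.>-nonZero (ℕ.<-trans ℕ.0<1+n 2≤q)

  frobenius : NontrivialInvolution F
  frobenius = record
    { σ = _^ q ; σ-cong = ^-cong q ; σ-+ = frobenius-+ ; σ-* = λ x y → ^-distribʳ-* x y q
    ; σ-involutive = frobenius-involutive ; θ = proj₁ ∃θ^q≉θ ; σθ≉θ = proj₂ ∃θ^q≉θ }

  open Conjugation frobenius public

  q+1-power≈1⇒norm≈1 : ∀ δ → δ ^ (q ℕ.+ 1) ≈ 1# → norm δ ≈ 1#
  q+1-power≈1⇒norm≈1 δ δ^[q+1]≈1 = begin
    δ * δ ^ q           ≈⟨ *-comm _ _ ⟩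
    δ ^ q * δ           ≈⟨ *-congˡ (*-identityʳ δ) ⟨
    δ ^ q * δ ^ 1       ≈⟨ ^-distribˡ-+-* δ q 1 ⟨
    δ ^ (q ℕ.+ 1)       ≈⟨ δ^[q+1]≈1 ⟩
    1#                  ∎

remQuot₃ : ∀ a r → Fin (a ℕ.* (r ℕ.* r)) → Fin a × Fin r × Fin r
remQuot₃ a r i = let (k , j) = Fin.remQuot (r ℕ.* r) i in k , Fin.remQuot r j

remQuot-injective : ∀ {a} b {i j : Fin (a ℕ.* b)} → Fin.remQuot {a} b i ≡ Fin.remQuot b j → i ≡ j
remQuot-injective {a} b {i} {j} eq =
  ≡.trans (≡.sym (Fin.combine-remQuot {a} b i)) (≡.trans (≡.cong (uncurry Fin.combine) eq) (Fin.combine-remQuot {a} b j))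

remQuot₃-injective : ∀ a r {i j} → remQuot₃ a r i ≡ remQuot₃ a r j → i ≡ j
remQuot₃-injective a r eq =
  remQuot-injective {a} (r ℕ.* r) (≡.cong₂ _,_ (≡.cong proj₁ eq) (remQuot-injective {r} r (≡.cong proj₂ eq)))

-- Imported only here: unqualified ℕ operators would clash with the field operations above.
open import Data.Nat using (ℕ; _≤_; _<_; _+_; _*_; _∸_; _^_)
open import Data.Fin using (Fin)
open import Data.Product using (Σ; _×_; _,_; proj₁; proj₂)
open import Relation.Binary.PropositionalEquality using (_≡_)

corollary1 : (q : ℕ) → IsPrimePower q → (F : FiniteField (q ^ 2)) →
    (δ : FiniteField.Carrier F) →
    FiniteField._≈_ F (FiniteField._^_ F δ (q + 1)) (FiniteField.1# F) →
    (m : ℕ) → 2 ≤ m → m < q →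
    Σ (Fin (q * ((q ∸ 1) * (q ∸ 1))) → FiniteField.Carrier F × FiniteField.Carrier F) λ L →
      ((i j : Fin (q * ((q ∸ 1) * (q ∸ 1)))) →
        FiniteField._≈_ F (proj₁ (L i)) (proj₁ (L j)) →
        FiniteField._≈_ F (proj₂ (L i)) (proj₂ (L j)) → i ≡ j) ×
      ((i : Fin (q * ((q ∸ 1) * (q ∸ 1)))) →
        HasRank2 q F (L i) × IsNormalizedPP q F δ m (L i))
corollary1 q q-prime-power F δ δ^[q+1]≈1 m 2≤m m<q =
  (λ i → let (k , u , v) = remQuot₃ q (q ∸ 1) i in α₀ k u v , α₁ k u v) ,
  (λ i j α₀≈ α₁≈ → remQuot₃-injective q (q ∸ 1) (α-injective α₀≈ α₁≈)) ,
  (λ i → let (k , u , v) = remQuot₃ q (q ∸ 1) i in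
         L-surjective k u v , T^m+L-permutation k u v , T^m+L-0 1≤m (α₀ k u v) (α₁ k u v))
  where
    2≤q : 2 ≤ q
    2≤q = ℕ.≤-trans 2≤m (ℕ.<⇒≤ m<q)
    1≤m : 1 ≤ m
    1≤m = ℕ.≤-trans (ℕ.s≤s ℕ.z≤n) 2≤m
    open QuadraticExtension q-prime-power 2≤q F
    open ConjugateShift δ (q+1-power≈1⇒norm≈1 δ δ^[q+1]≈1)
    open PermutationFamily m (fixedElements {q} q^2≡q*q) (nonzeroFixedElements {q} q^2≡q*q)
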